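{- Suppose the directed Dynkin diagram $D$ (as an undirected graph on $\Delta$) is a path. Let $S\subseteq\Delta$ be a set of simple roots with a fixed ordering $S=(\beta_1,\dots,\beta_n)$. Then for any boolean elements $u,w\in W$ there exists at most one non-equivariant boolean insertion path $u\xrightarrow{S}w$.
   Context: Let $W$ be the Weyl group of a root system $\Phi$ with simple roots $\Delta=\{\alpha_1,\dots,\alpha_r\}$, simple reflections $s_i=s_{\alpha_i}$, Coxeter length $\ell$, and invariant inner product $\langle\cdot,\cdot\rangle$. $\supp(w)$ is the set of $\alpha_i$ such that $s_i$ appears in some (equivalently every) reduced word of $w$; $w$ is boolean if $\ell(w)=|\supp(w)|$. Directed Dynkin diagram $D$: vertex set $\Delta$, with exactly $-2\langle\alpha,\beta\rangle/\langle\beta,\beta\rangle$ directed edges from $\alpha$ to $\beta$ for $\alpha\ne\beta$; $\alpha,\beta$ are adjacent if some edge joins them. Paths never repeat vertices. Boolean diagram: for boolean $w$, $B(w)$ is the directed graph on $\supp(w)$ with an arrow $\alpha_k\to\alpha_j$ whenever $\alpha_j,\alpha_k$ are adjacent in $D$ and $s_j$ appears before $s_k$ in the reduced words of $w$. $B(u)\subseteq B(w)$ means $\supp(u)\subseteq\supp(w)$ and each arrow of $B(u)$ is an arrow of $B(w)$. Non-equivariant boolean insertion: for boolean $u,v$ and $\alpha\in\Delta$, $u\xrightarrow{\alpha}v$ is a non-equivariant boolean insertion if either (1) $\alpha\in\supp(u)$, $\ell(v)=\ell(u)+1$, $B(u)\subseteq B(v)$, and there is a directed path in $B(v)$ from $\alpha$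 to the unique vertex of $\supp(v)\setminus\supp(u)$; or (3) $\alpha\notin\supp(u)$, $\ell(v)=\ell(u)+1$, $B(u)\subseteq B(v)$ and $\supp(v)\setminus\supp(u)=\{\alpha\}$. A non-equivariant boolean insertion path $u\xrightarrow{S}w$ is a sequence $u=u^{(0)}\xrightarrow{\beta_1}u^{(1)}\xrightarrow{\beta_2}\cdots\xrightarrow{\beta_n}u^{(n)}=w$ of non-equivariant boolean insertions of boolean elements. -}

module Defs where

open import Data.Nat using (ℕ; zero; suc; NonZero) renaming (_≤_ to _≤ℕ_)
open import Data.Integer using (ℤ; +_; 0ℤ; _+_; _-_; _*_; _≤_; _<_)
open import Data.Fin using (Fin; zero; suc; toℕ; _≟_)
open import Data.List using (List; []; _∷_; _++_; length)
open import Data.List.Membership.Propositional using (_∈_)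
open import Data.List.Relation.Unary.Unique.Propositional using (Unique)
open import Data.Product using (Σ; ∃; ∃-syntax; _×_; _,_)
open import Data.Sum using (_⊎_)
open import Data.Fin.Permutation using (Permutation′; _⟨$⟩ʳ_)
open import Relation.Nullary using (¬_; yes; no)
open import Relation.Binary.PropositionalEquality using (_≡_; _≢_)

sumFin : (n : ℕ) → (Fin n → ℤ) → ℤ
sumFin zero    f = 0ℤ
sumFin (suc n) f = f zero + sumFin n (λ i → f (suc i))

-- Cartan data of a (finite, crystallographic) root system with simple roots
-- α_0 … α_{r-1}.  a i j = 2⟨α_i,α_j⟩/⟨α_j,α_j⟩ (so D has exactly - a i j
-- edges from α_i to α_j), and d j is a positive integer proportional to
-- ⟨α_j,α_j⟩, so that ⟨α_i,α_j⟩ is proportional to a i j * d j.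
-- The Gram matrix of the simple roots must be symmetric and positive definite.
record CartanData (r : ℕ) : Set where
  field
    a       : Fin r → Fin r → ℤ
    d       : Fin r → ℕ
    d-pos   : ∀ i → NonZero (d i)
    diag    : ∀ i → a i i ≡ + 2
    offdiag : ∀ i j → i ≢ j → a i j ≤ 0ℤ
    symm    : ∀ i j → a i j * + d j ≡ a j i * + d i
    posdef  : (x : Fin r → ℤ) → (∃[ i ] (x i ≢ 0ℤ)) →
              0ℤ < sumFin r (λ i → sumFin r (λ j → x i * (a i j * + d j) * x j))

module _ {r : ℕ} (R : CartanData r) where
  open CartanData R

  Adj : Fin r → Fin r → Set
  Adj i j = i ≢ j × (a i j ≢ 0ℤ ⊎ a j i ≢ 0ℤ)

  -- D, as an undirected graph, is a path: vertices can be numbered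
  -- 0,…,r-1 so that adjacency is exactly "consecutive numbers".
  Consecutive : ℕ → ℕ → Set
  Consecutive m n = m ≡ suc n ⊎ n ≡ suc m

  DynkinIsPath : Set
  DynkinIsPath = Σ (Permutation′ r) λ π → ∀ i j →
    (Adj i j → Consecutive (toℕ (π ⟨$⟩ʳ i)) (toℕ (π ⟨$⟩ʳ j))) ×
    (Consecutive (toℕ (π ⟨$⟩ʳ i)) (toℕ (π ⟨$⟩ʳ j)) → Adj i j)

  -- simple reflection s_i acting on root-lattice coordinates:
  -- s_i(x) = x - ⟨x, α_i^∨⟩ α_i, with ⟨α_j, α_i^∨⟩ = a j i.
  refl : Fin r → (Fin r → ℤ) → (Fin r → ℤ)
  refl i x k with k ≟ i
  ... | yes _ = x i - sumFin r (λ j → x j * a j i)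
  ... | no  _ = x k

  -- Words in the simple reflections; the word i₁ i₂ … iₘ is s_{i₁} s_{i₂} ⋯ s_{iₘ}.
  Word : Set
  Word = List (Fin r)

  act : Word → (Fin r → ℤ) → (Fin r → ℤ)
  act []      x = x
  act (i ∷ w) x = refl i (act w x)

  _≈_ : Word → Word → Set
  w ≈ v = ∀ x k → act w x k ≡ act v x k

  Reduced : Word → Set
  Reduced w = ∀ v → v ≈ w → length w ≤ℕ length v

  Len : Word → ℕ → Set
  Len w n = ∃[ v ] (Reduced v × v ≈ w × length v ≡ n)

  InSupp : Word → Fin r → Set
  InSupp w i = ∃[ v ] (Reduced v × v ≈ w × i ∈ v)

  -- ℓ(w) = |supp(w)|
  Boolean : Word → Set
  Boolean w = ∃[ n ] (Len w n × ∃[ L ] (Unique L × (∀ i → i ∈ L → InSupp w i)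
                                         × (∀ i → InSupp w i → i ∈ L) × length L ≡ n))

  Before : Word → Fin r → Fin r → Set
  Before w j k = ∃[ v ] (Reduced v × v ≈ w ×
                   ∃[ p ] ∃[ q ] ∃[ s ] (v ≡ p ++ (j ∷ q ++ (k ∷ s))))

  -- arrow α_k → α_j in B(w)
  Arrow : Word → Fin r → Fin r → Set
  Arrow w k j = InSupp w j × InSupp w k × Adj j k × Before w j k

  SubDiagram : Word → Word → Set
  SubDiagram u w = (∀ i → InSupp u i → InSupp w i) × (∀ k j → Arrow u k j → Arrow w k j)

  data WalkIn (w : Word) : Fin r → Fin r → List (Fin r) → Set where
    here : ∀ b → WalkIn w b b (b ∷ [])
    step : ∀ b c e vs → Arrow w b c → WalkIn w c e vs → WalkIn w b e (b ∷ vs)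

  HasPath : Word → Fin r → Fin r → Set
  HasPath w b e = ∃[ vs ] (WalkIn w b e vs × Unique vs)

  LenSucc : Word → Word → Set
  LenSucc u v = ∃[ n ] (Len u n × Len v (suc n))

  Insertion : Word → Fin r → Word → Set
  Insertion u α v = Boolean u × Boolean v ×
    ( (InSupp u α × LenSucc u v × SubDiagram u v ×
         ∃[ γ ] ((InSupp v γ × ¬ InSupp u γ × (∀ δ → InSupp v δ → ¬ InSupp u δ → δ ≡ γ))
                 × HasPath v α γ))
    ⊎ (¬ InSupp u α × LenSucc u v × SubDiagram u v ×
         (∀ δ → InSupp v δ → ¬ InSupp u δ → δ ≡ α) × InSupp v α))

  -- sequence of insertions u = u⁽⁰⁾ --β₁--> u⁽¹⁾ … --βₙ--> u⁽ⁿ⁾, listing u⁽¹⁾ … u⁽ⁿ⁾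
  data InsSeq : Word → List (Fin r) → List Word → Set where
    done : ∀ u → InsSeq u [] []
    cons : ∀ u β v S vs → Insertion u β v → InsSeq v S vs → InsSeq u (β ∷ S) (v ∷ vs)

  endpoint : Word → List Word → Word
  endpoint u []       = u
  endpoint u (v ∷ vs) = endpoint v vs

  InsPath : Word → List (Fin r) → Word → List Word → Set
  InsPath u S w vs = InsSeq u S vs × endpoint u vs ≈ w

{-# OPTIONS --safe #-}

-- An insertion adds one vertex γ to the support: β itself, or the end of a directed path from β in
-- the new boolean diagram, and every arrow created along the way survives into B(w). On a path-shaped
-- Dynkin diagram such a path runs monotonically along the line, so two insertion paths from u with the
-- same letters add the same vertex at every step: if the two new vertices lay on the same side of β,
-- the path to the farther one would pass through the nearer one, which is not yet present; if they
-- lay on opposite sides, β would have no incoming arrow in B(w), so no later insertion could cross β,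
-- and counting the vertices of w beyond β along the two paths would give results differing by one.
-- Equal supports then force equal elements, because a boolean element is determined by its support
-- together with the order of adjacent letters, which is the same in all its reduced words. These
-- facts about reduced words rest on the positivity theorem (ℓ(y s_i) > ℓ(y) implies y(α_i) > 0),
-- proved by reduction to the finite dihedral groups of rank two.

module Submission where

open import Defs hiding (refl)
open import Data.Bool using (Bool; true; false)
open import Data.Empty using (⊥; ⊥-elim)
open import Data.Fin using (Fin; zero; suc; toℕ; fromℕ<; punchIn; _≟_)
import Data.Fin.Properties as Finₚ
open import Data.Fin.Permutation using (_⟨$⟩ʳ_; _⟨$⟩ˡ_; inverseˡ)
open import Data.Integer as ℤ using (ℤ; +_; -[1+_]; +[1+_]; 0ℤ; _+_; _-_; _*_; -_; +≤+; nonNegative)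
import Data.Integer.Properties as ℤₚ
open import Data.Integer.Tactic.RingSolver using (solve-∀)
open import Data.List as List using (List; []; _∷_; _++_; [_]; length; reverse; map)
import Data.List.Properties as Listₚ
open import Data.List.Membership.Propositional using (_∈_; _∉_)
open import Data.List.Membership.Propositional.Properties using (∈-++⁺ˡ; ∈-++⁺ʳ; ∈-++⁻; ∈-∃++)
import Data.List.Membership.DecPropositional as DecMembership
open import Data.List.Relation.Binary.Pointwise as Pointwise using (Pointwise; []; _∷_)
open import Data.List.Relation.Binary.Subset.Propositional using (_⊆_)
open import Data.List.Relation.Unary.All as All using (All; []; _∷_)
import Data.List.Relation.Unary.All.Properties as Allₚ
open import Data.List.Relation.Unary.AllPairs using ([]; _∷_)
open import Data.List.Relation.Unary.Any using (here; there)
import Data.List.Relation.Unary.Any.Properties as Anyₚ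
import Data.List.Relation.Unary.First as First
import Data.List.Relation.Unary.First.Properties as Firstₚ
open import Data.List.Relation.Unary.Unique.Propositional using (Unique)
open import Data.List.Relation.Unary.Unique.Propositional.Properties using (Unique[x∷xs]⇒x∉xs)
open import Data.Nat as ℕ using (ℕ; zero; suc; _≤_; _<_; _<?_; z≤n; s≤s; _∸_)
open import Data.Nat.Induction using (<-wellFounded)
import Data.Nat.Properties as ℕₚ
open import Data.Product as Product using (∃; ∃₂; _×_; _,_; proj₁; proj₂)
open import Data.Sum as Sum using (_⊎_; inj₁; inj₂; [_,_]′)
open import Function using (_∘_; mk⇔)
open import Induction.WellFounded using (Acc; acc)
open import Relation.Binary.Bundles using (Setoid)
open import Relation.Binary.Definitions using (DecidableEquality; Tri; tri<; tri≈; tri>)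
open import Relation.Binary.PropositionalEquality hiding ([_])
import Relation.Binary.Reasoning.Setoid as SetoidReasoning
open import Relation.Binary.Structures using (IsEquivalence)
open import Relation.Nullary using (¬_; Dec; yes; no; does)
open import Relation.Nullary.Decidable
  using (True; toWitness; map′; _×-dec_; _⊎-dec_; toSum; decidable-stable; ¬¬-excluded-middle; does-⇔; dec-true; dec-false)
open import Algebra.Properties.CommutativeMonoid.Sum ℕₚ.+-0-commutativeMonoid using (sum; sum-cong-≗; sum-remove)
open import Algebra.Properties.CommutativeSemigroup ℤₚ.+-commutativeSemigroup using () renaming (interchange to +-interchange)

sumFin-cong : ∀ n {f g : Fin n → ℤ} → f ≗ g → sumFin n f ≡ sumFin n g
sumFin-cong zero    f≗g = refl
sumFin-cong (suc n) f≗g = cong₂ _+_ (f≗g zero) (sumFin-cong n (f≗g ∘ suc))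

sumFin-+ : ∀ n (f g : Fin n → ℤ) → sumFin n (λ j → f j + g j) ≡ sumFin n f + sumFin n g
sumFin-+ zero    f g = refl
sumFin-+ (suc n) f g =
  trans (cong (_+_ (f zero + g zero)) (sumFin-+ n (f ∘ suc) (g ∘ suc))) (+-interchange (f zero) (g zero) _ _)

sumFin-*ˡ : ∀ n c (f : Fin n → ℤ) → sumFin n (λ j → c * f j) ≡ c * sumFin n f
sumFin-*ˡ zero    c f = sym (ℤₚ.*-zeroʳ c)
sumFin-*ˡ (suc n) c f =
  trans (cong (_+_ (c * f zero)) (sumFin-*ˡ n c _)) (sym (ℤₚ.*-distribˡ-+ c (f zero) _))

sumFin-nonpos : ∀ n (f : Fin n → ℤ) → (∀ j → f j ℤ.≤ 0ℤ) → sumFin n f ℤ.≤ 0ℤ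
sumFin-nonpos zero    f f≤0 = ℤₚ.≤-refl
sumFin-nonpos (suc n) f f≤0 = ℤₚ.+-mono-≤ (f≤0 zero) (sumFin-nonpos n _ (f≤0 ∘ suc))

sumFin-zero : ∀ n (f : Fin n → ℤ) → (∀ j → f j ≡ 0ℤ) → sumFin n f ≡ 0ℤ
sumFin-zero zero    f f≡0 = refl
sumFin-zero (suc n) f f≡0 = cong₂ _+_ (f≡0 zero) (sumFin-zero n _ (f≡0 ∘ suc))

sumFin-single : ∀ n (f : Fin n → ℤ) i → (∀ j → j ≢ i → f j ≡ 0ℤ) → sumFin n f ≡ f i
sumFin-single (suc n) f zero    f≡0 =
  trans (cong (_+_ (f zero)) (sumFin-zero n _ (λ j → f≡0 (suc j) λ ()))) (ℤₚ.+-identityʳ _)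
sumFin-single (suc n) f (suc i) f≡0 =
  trans (cong₂ _+_ (f≡0 zero λ ()) (sumFin-single n _ i (λ j j≢i → f≡0 (suc j) (j≢i ∘ Finₚ.suc-injective))))
        (ℤₚ.+-identityˡ _)

sumFin-pair : ∀ n (f : Fin n → ℤ) s t → s ≢ t → (∀ j → j ≢ s → j ≢ t → f j ≡ 0ℤ) →
              sumFin n f ≡ f s + f t
sumFin-pair (suc n) f zero    zero    s≢t f≡0 = ⊥-elim (s≢t refl)
sumFin-pair (suc n) f zero    (suc t) s≢t f≡0 =
  cong (_+_ (f zero)) (sumFin-single n _ t (λ j j≢t → f≡0 (suc j) (λ ()) (j≢t ∘ Finₚ.suc-injective)))
sumFin-pair (suc n) f (suc s) zero    s≢t f≡0 =
  trans (cong (_+_ (f zero)) (sumFin-single n _ s (λ j j≢s → f≡0 (suc j) (j≢s ∘ Finₚ.suc-injective) (λ ()))))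
        (ℤₚ.+-comm (f zero) _)
sumFin-pair (suc n) f (suc s) (suc t) s≢t f≡0 =
  trans (cong₂ _+_ (f≡0 zero (λ ()) (λ ())) (sumFin-pair n _ s t (s≢t ∘ cong suc)
                     (λ j j≢s j≢t → f≡0 (suc j) (j≢s ∘ Finₚ.suc-injective) (j≢t ∘ Finₚ.suc-injective))))
        (ℤₚ.+-identityˡ _)

sumFin-≤-term : ∀ n (f : Fin n → ℤ) i → (∀ j → j ≢ i → f j ℤ.≤ 0ℤ) → sumFin n f ℤ.≤ f i
sumFin-≤-term (suc n) f zero    f≤0 =
  ℤₚ.≤-trans (ℤₚ.+-monoʳ-≤ (f zero) (sumFin-nonpos n _ (λ j → f≤0 (suc j) λ ())))
             (ℤₚ.≤-reflexive (ℤₚ.+-identityʳ _))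
sumFin-≤-term (suc n) f (suc i) f≤0 =
  ℤₚ.≤-trans (ℤₚ.+-monoˡ-≤ _ (f≤0 zero λ ()))
    (ℤₚ.≤-trans (ℤₚ.≤-reflexive (ℤₚ.+-identityˡ _))
                (sumFin-≤-term n _ i (λ j j≢i → f≤0 (suc j) (j≢i ∘ Finₚ.suc-injective))))

*-nonNeg-nonPos : ∀ x y → 0ℤ ℤ.≤ x → y ℤ.≤ 0ℤ → x * y ℤ.≤ 0ℤ
*-nonNeg-nonPos x y 0≤x y≤0 = subst (x * y ℤ.≤_) (ℤₚ.*-zeroʳ x) (ℤₚ.*-monoˡ-≤-nonNeg x {{nonNegative 0≤x}} y≤0)

*-nonNeg-nonNeg : ∀ x y → 0ℤ ℤ.≤ x → 0ℤ ℤ.≤ y → 0ℤ ℤ.≤ x * y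
*-nonNeg-nonNeg x y 0≤x 0≤y = subst (ℤ._≤ x * y) (ℤₚ.*-zeroʳ x) (ℤₚ.*-monoˡ-≤-nonNeg x {{nonNegative 0≤x}} 0≤y)

¬¬-least : ∀ (P : ℕ → Set) n → P n → ¬ ¬ (∃ λ k → P k × ∀ j → P j → k ≤ j)
¬¬-least P n pn = go n (<-wellFounded n) pn
  where
  go : ∀ n → Acc _<_ n → P n → ¬ ¬ (∃ λ k → P k × ∀ j → P j → k ≤ j)
  go n (acc smaller) pn ¬least = ¬¬-excluded-middle {A = ∃ λ j → j < n × P j} λ where
    (yes (j , j<n , pj)) → go j (smaller j<n) pj ¬least
    (no  none)           → ¬least (n , pn , λ j pj → ℕₚ.≮⇒≥ (λ j<n → none (j , j<n , pj)))


module _ {A : Set} where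

  ∈-insert-middle : ∀ (xs : List A) {y ys x} → x ∈ xs ++ ys → x ∈ xs ++ y ∷ ys
  ∈-insert-middle xs x∈ = [ ∈-++⁺ˡ , ∈-++⁺ʳ xs ∘ there ]′ (∈-++⁻ xs x∈)

  ∈-remove-middle : ∀ (xs : List A) {y ys x} → x ∈ xs ++ y ∷ ys → x ≢ y → x ∈ xs ++ ys
  ∈-remove-middle xs x∈ x≢y with ∈-++⁻ xs x∈
  ... | inj₁ x∈xs          = ∈-++⁺ˡ x∈xs
  ... | inj₂ (here x≡y)    = ⊥-elim (x≢y x≡y)
  ... | inj₂ (there x∈ys)  = ∈-++⁺ʳ xs x∈ys

  length-insert-middle : ∀ (xs : List A) {y ys} → length (xs ++ y ∷ ys) ≡ suc (length (xs ++ ys))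
  length-insert-middle []       = refl
  length-insert-middle (_ ∷ xs) = cong suc (length-insert-middle xs)

  Unique-++⁻ˡ : ∀ (xs : List A) {ys} → Unique (xs ++ ys) → Unique xs
  Unique-++⁻ˡ []       _            = []
  Unique-++⁻ˡ (x ∷ xs) (x∉ ∷ uniq) = Allₚ.++⁻ˡ xs x∉ ∷ Unique-++⁻ˡ xs uniq

  Unique-++⁻ʳ : ∀ (xs : List A) {ys} → Unique (xs ++ ys) → Unique ys
  Unique-++⁻ʳ []       uniq         = uniq
  Unique-++⁻ʳ (x ∷ xs) (_ ∷ uniq)  = Unique-++⁻ʳ xs uniq

  Unique-++-disjoint : ∀ (xs : List A) {ys x} → Unique (xs ++ ys) → x ∈ xs → x ∉ ys
  Unique-++-disjoint (x ∷ xs) (x∉ ∷ _)    (here refl) x∈ys = All.lookup (Allₚ.++⁻ʳ xs x∉) x∈ys refl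
  Unique-++-disjoint (_ ∷ xs) (_ ∷ uniq)  (there x∈)  x∈ys = Unique-++-disjoint xs uniq x∈ x∈ys

  Unique-remove-middle : ∀ (xs : List A) {y ys} → Unique (xs ++ y ∷ ys) → Unique (xs ++ ys)
  Unique-remove-middle []       (_ ∷ uniq)   = uniq
  Unique-remove-middle (x ∷ xs) (x∉ ∷ uniq) = Allₚ.++⁺ (Allₚ.++⁻ˡ xs x∉) (All.tail (Allₚ.++⁻ʳ xs x∉)) ∷ Unique-remove-middle xs uniq

  Unique-middle-∉ : ∀ (xs : List A) {y ys} → Unique (xs ++ y ∷ ys) → y ∉ xs ++ ys
  Unique-middle-∉ xs uniq y∈ with ∈-++⁻ xs y∈
  ... | inj₁ y∈xs = Unique-++-disjoint xs uniq y∈xs (here refl)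
  ... | inj₂ y∈ys = Unique[x∷xs]⇒x∉xs (Unique-++⁻ʳ xs uniq) y∈ys

  ∈-split-first : DecidableEquality A → ∀ {x} {xs : List A} → x ∈ xs → ∃₂ λ p q → xs ≡ p ++ x ∷ q × x ∉ p
  ∈-split-first _≟_ {x} {xs} x∈xs with First.first (λ y → [ inj₂ , inj₁ ]′ (toSum (x ≟ y))) xs
  ... | inj₂ all≢ = ⊥-elim (All.lookup all≢ x∈xs refl)
  ... | inj₁ first with Firstₚ.toView first
  ...   | First._++_∷_ {xs = p} x≢p refl q = p , q , refl , λ x∈p → All.lookup x≢p x∈p refl

  Unique-⊆⇒length-≤ : ∀ {xs ys : List A} → Unique xs → xs ⊆ ys → length xs ≤ length ys
  Unique-⊆⇒length-≤ {[]}     _             _     = z≤n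
  Unique-⊆⇒length-≤ {x ∷ xs} {ys} (x∉ ∷ uniq) x∷xs⊆ys with ∈-∃++ (x∷xs⊆ys (here refl))
  ... | p , q , refl = subst (suc (length xs) ≤_) (sym (length-insert-middle p)) (s≤s (Unique-⊆⇒length-≤ uniq xs⊆pq))
    where
    xs⊆pq : xs ⊆ p ++ q
    xs⊆pq y∈ = ∈-remove-middle p (x∷xs⊆ys (there y∈)) (λ { refl → All.lookup x∉ y∈ refl })

  ⊆-∷⁻-∉ : ∀ {xs : List A} {y ys} → xs ⊆ y ∷ ys → y ∉ xs → xs ⊆ ys
  ⊆-∷⁻-∉ xs⊆ y∉xs z∈ with xs⊆ z∈
  ... | here refl  = ⊥-elim (y∉xs z∈)
  ... | there z∈ys = z∈ys

  ⊆-∷⁻-∈ : ∀ {xs : List A} {y ys} → xs ⊆ y ∷ ys → y ∈ ys → xs ⊆ ys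
  ⊆-∷⁻-∈ xs⊆ y∈ys z∈ with xs⊆ z∈
  ... | here refl  = y∈ys
  ... | there z∈ys = z∈ys

  longer-⊈ : ∀ {xs ys : List A} → Unique xs → length ys < length xs → ¬ xs ⊆ ys
  longer-⊈ uniq |ys|<|xs| xs⊆ys = ℕₚ.<⇒≱ |ys|<|xs| (Unique-⊆⇒length-≤ uniq xs⊆ys)

  module _ (_≟_ : DecidableEquality A) where
    open DecMembership _≟_ using (_∈?_)

    pigeonhole : ∀ {xs ys : List A} → Unique xs → xs ⊆ ys → length ys ≤ length xs → Unique ys
    pigeonhole {xs} {[]}     _    _   _          = []
    pigeonhole {xs} {y ∷ ys} uniq xs⊆ |y∷ys|≤|xs| with y ∈? xs
    ... | no  y∉xs = ⊥-elim (longer-⊈ uniq |y∷ys|≤|xs| (⊆-∷⁻-∉ xs⊆ y∉xs))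
    ... | yes y∈xs with ∈-∃++ y∈xs
    ...   | p , q , refl =
      All.tabulate (λ { z∈ys refl → longer-⊈ uniq |y∷ys|≤|xs| (⊆-∷⁻-∈ xs⊆ z∈ys) })
      ∷ pigeonhole (Unique-remove-middle p uniq)
                   (⊆-∷⁻-∉ (xs⊆ ∘ ∈-insert-middle p) (Unique-middle-∉ p uniq))
                   (ℕₚ.≤-pred (subst (suc (length ys) ≤_) (length-insert-middle p) |y∷ys|≤|xs|))

data Precedes {A : Set} : List A → A → A → Set where
  here  : ∀ {j k w} → k ∈ w → Precedes (j ∷ w) j k
  there : ∀ {x j k w} → Precedes w j k → Precedes (x ∷ w) j k

module _ {A : Set} where

  Precedes⇒∈ˡ : ∀ {w : List A} {j k} → Precedes w j k → j ∈ w
  Precedes⇒∈ˡ (here _)  = here refl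
  Precedes⇒∈ˡ (there p) = there (Precedes⇒∈ˡ p)

  Precedes⇒∈ʳ : ∀ {w : List A} {j k} → Precedes w j k → k ∈ w
  Precedes⇒∈ʳ (here k∈) = there k∈
  Precedes⇒∈ʳ (there p) = there (Precedes⇒∈ʳ p)

  Precedes-++ : ∀ (p : List A) {j q k s} → Precedes (p ++ j ∷ q ++ k ∷ s) j k
  Precedes-++ []      {q = q} = here (∈-++⁺ʳ q (here refl))
  Precedes-++ (_ ∷ p)         = there (Precedes-++ p)

  Precedes⇒++ : ∀ {w : List A} {j k} → Precedes w j k → ∃₂ λ p q → ∃ λ s → w ≡ p ++ j ∷ q ++ k ∷ s
  Precedes⇒++ (here k∈) with ∈-∃++ k∈
  ... | q , s , refl = [] , q , s , refl
  Precedes⇒++ {w = x ∷ _} (there pr) with Precedes⇒++ pr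
  ... | p , q , s , refl = x ∷ p , q , s , refl

  Precedes-asym : ∀ {w : List A} {j k} → Unique w → Precedes w j k → ¬ Precedes w k j
  Precedes-asym (j∉ ∷ _)    (here k∈)  (here _)   = All.lookup j∉ k∈ refl
  Precedes-asym (j∉ ∷ _)    (here _)   (there pr) = All.lookup j∉ (Precedes⇒∈ʳ pr) refl
  Precedes-asym (k∉ ∷ _)    (there pr) (here _)   = All.lookup k∉ (Precedes⇒∈ʳ pr) refl
  Precedes-asym (_ ∷ uniq)  (there pr) (there pr′) = Precedes-asym uniq pr pr′

  Precedes-total : ∀ {w : List A} {j k} → j ∈ w → k ∈ w → j ≢ k → Precedes w j k ⊎ Precedes w k j
  Precedes-total (here refl) (here refl) j≢k = ⊥-elim (j≢k refl)
  Precedes-total (here refl) (there k∈)  _   = inj₁ (here k∈)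
  Precedes-total (there j∈)  (here refl) _   = inj₂ (here j∈)
  Precedes-total (there j∈)  (there k∈)  j≢k = Sum.map there there (Precedes-total j∈ k∈ j≢k)

  Precedes-∷⁻ : ∀ {i} {w : List A} {j k} → Precedes (i ∷ w) j k → j ≢ i → Precedes w j k
  Precedes-∷⁻ (here _)   j≢i = ⊥-elim (j≢i refl)
  Precedes-∷⁻ (there pr) _   = pr

  Precedes-remove-middle : ∀ (p : List A) {i q j k} → Precedes (p ++ i ∷ q) j k → j ≢ i → k ≢ i → Precedes (p ++ q) j k
  Precedes-remove-middle []      (here _)   j≢i _   = ⊥-elim (j≢i refl)
  Precedes-remove-middle []      (there pr) _   _   = pr
  Precedes-remove-middle (_ ∷ p) (here k∈)  _   k≢i = here (∈-remove-middle p k∈ k≢i)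
  Precedes-remove-middle (_ ∷ p) (there pr) j≢i k≢i = there (Precedes-remove-middle p pr j≢i k≢i)

  Precedes-middle : ∀ (p : List A) {i q l} → l ∈ p → Precedes (p ++ i ∷ q) l i
  Precedes-middle (_ ∷ p) (here refl) = here (∈-++⁺ʳ p (here refl))
  Precedes-middle (_ ∷ p) (there l∈)  = there (Precedes-middle p l∈)

  Precedes-middle⁻ : ∀ (p : List A) {i q k} → Unique (p ++ i ∷ q) → Precedes (p ++ i ∷ q) k i → k ∈ p
  Precedes-middle⁻ []      (i∉ ∷ _)   (here i∈)  = ⊥-elim (All.lookup i∉ i∈ refl)
  Precedes-middle⁻ []      (i∉ ∷ _)   (there pr) = ⊥-elim (All.lookup i∉ (Precedes⇒∈ʳ pr) refl)
  Precedes-middle⁻ (_ ∷ p) _          (here _)   = here refl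
  Precedes-middle⁻ (_ ∷ p) (_ ∷ uniq) (there pr) = there (Precedes-middle⁻ p uniq pr)


module RankTwo where

  data Gen₂ : Set where
    S T : Gen₂

  swap : Gen₂ → Gen₂
  swap S = T
  swap T = S

  alternating : Gen₂ → ℕ → List Gen₂
  alternating c zero    = []
  alternating c (suc n) = c ∷ alternating (swap c) n

  alternating-length : ∀ c n → length (alternating c n) ≡ n
  alternating-length c zero    = refl
  alternating-length c (suc n) = cong suc (alternating-length (swap c) n)

  alternating-+ : ∀ c j m → ∃ λ c′ → alternating c (j ℕ.+ m) ≡ alternating c j ++ alternating c′ m
  alternating-+ c zero    m = c , refl
  alternating-+ c (suc j) m with alternating-+ (swap c) j m
  ... | c′ , eq = c′ , cong (c ∷_) eq

  EndsWithS : List Gen₂ → Set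
  EndsWithS w = ∃ λ pre → w ≡ pre ++ [ S ]

  endsWithS? : ∀ w → Dec (EndsWithS w)
  endsWithS? w with List.initLast w
  ... | List.[]         = no λ { (pre , eq) → [S]≢[] (Listₚ.++-conicalʳ pre [ S ] (sym eq)) }
    where
    [S]≢[] : [ S ] ≢ []
    [S]≢[] ()
  ... | pre List.∷ʳ′ S = yes (pre , refl)
  ... | pre List.∷ʳ′ T = no λ { (pre′ , eq) → T≢S (Listₚ.∷ʳ-injectiveʳ pre pre′ eq) }
    where
    T≢S : T ≢ S
    T≢S ()

  -- For simple roots α_s, α_t with a s t = A and a t s = B, the reflections s_s and s_t act on
  -- ⟨ x_s , x_t , ⟨x, α_s^∨⟩ , ⟨x, α_t^∨⟩ ⟩ through reflect₂ A B, whatever the other coordinates of x.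
  record Q4 : Set where
    constructor ⟨_,_,_,_⟩
    field X Y P Q : ℤ
  open Q4 public

  reflect₂ : ℤ → ℤ → Gen₂ → Q4 → Q4
  reflect₂ A B S ⟨ x , y , p , q ⟩ = ⟨ x - p , y , p - p * + 2 , q - p * A ⟩
  reflect₂ A B T ⟨ x , y , p , q ⟩ = ⟨ x , y - q , p - q * B , q - q * + 2 ⟩

  act₂ : ℤ → ℤ → List Gen₂ → Q4 → Q4
  act₂ A B w v = List.foldr (reflect₂ A B) v w

  ⟨⟩-cong : ∀ {x y p q x′ y′ p′ q′} → x ≡ x′ → y ≡ y′ → p ≡ p′ → q ≡ q′ →
            ⟨ x , y , p , q ⟩ ≡ ⟨ x′ , y′ , p′ , q′ ⟩
  ⟨⟩-cong refl refl refl refl = refl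

  _≟Q4_ : (u v : Q4) → Dec (u ≡ v)
  ⟨ x , y , p , q ⟩ ≟Q4 ⟨ x′ , y′ , p′ , q′ ⟩ =
    map′ (λ (ex , ey , ep , eq) → ⟨⟩-cong ex ey ep eq) (λ { refl → refl , refl , refl , refl })
         (x ℤ.≟ x′ ×-dec y ℤ.≟ y′ ×-dec p ℤ.≟ p′ ×-dec q ℤ.≟ q′)

  infixr 6 _⊕_
  infixr 7 _⊙_

  _⊕_ : Q4 → Q4 → Q4
  ⟨ x , y , p , q ⟩ ⊕ ⟨ x′ , y′ , p′ , q′ ⟩ = ⟨ x + x′ , y + y′ , p + p′ , q + q′ ⟩

  _⊙_ : ℤ → Q4 → Q4
  k ⊙ ⟨ x , y , p , q ⟩ = ⟨ k * x , k * y , k * p , k * q ⟩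

  private
    sub-+ : ∀ a a′ b b′ k → (a + a′) - (b + b′) * k ≡ (a - b * k) + (a′ - b′ * k)
    sub-+ = solve-∀

    sub-+′ : ∀ a a′ b b′ → (a + a′) - (b + b′) ≡ (a - b) + (a′ - b′)
    sub-+′ = solve-∀

    sub-* : ∀ c a b k → c * a - c * b * k ≡ c * (a - b * k)
    sub-* = solve-∀

    sub-*′ : ∀ c a b → c * a - c * b ≡ c * (a - b)
    sub-*′ = solve-∀

  reflect₂-⊕ : ∀ A B c u v → reflect₂ A B c (u ⊕ v) ≡ reflect₂ A B c u ⊕ reflect₂ A B c v
  reflect₂-⊕ A B S ⟨ x , y , p , q ⟩ ⟨ x′ , y′ , p′ , q′ ⟩ =
    ⟨⟩-cong (sub-+′ x x′ p p′) refl (sub-+ p p′ p p′ (+ 2)) (sub-+ q q′ p p′ A)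
  reflect₂-⊕ A B T ⟨ x , y , p , q ⟩ ⟨ x′ , y′ , p′ , q′ ⟩ =
    ⟨⟩-cong refl (sub-+′ y y′ q q′) (sub-+ p p′ q q′ B) (sub-+ q q′ q q′ (+ 2))

  reflect₂-⊙ : ∀ A B c k u → reflect₂ A B c (k ⊙ u) ≡ k ⊙ reflect₂ A B c u
  reflect₂-⊙ A B S k ⟨ x , y , p , q ⟩ = ⟨⟩-cong (sub-*′ k x p) refl (sub-* k p p (+ 2)) (sub-* k q p A)
  reflect₂-⊙ A B T k ⟨ x , y , p , q ⟩ = ⟨⟩-cong refl (sub-*′ k y q) (sub-* k p q B) (sub-* k q q (+ 2))

  act₂-⊕ : ∀ A B w u v → act₂ A B w (u ⊕ v) ≡ act₂ A B w u ⊕ act₂ A B w v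
  act₂-⊕ A B []      u v = refl
  act₂-⊕ A B (c ∷ w) u v = trans (cong (reflect₂ A B c) (act₂-⊕ A B w u v)) (reflect₂-⊕ A B c (act₂ A B w u) (act₂ A B w v))

  act₂-⊙ : ∀ A B w k u → act₂ A B w (k ⊙ u) ≡ k ⊙ act₂ A B w u
  act₂-⊙ A B []      k u = refl
  act₂-⊙ A B (c ∷ w) k u = trans (cong (reflect₂ A B c) (act₂-⊙ A B w k u)) (reflect₂-⊙ A B c k (act₂ A B w u))

  e₁ e₂ e₃ e₄ : Q4
  e₁ = ⟨ + 1 , 0ℤ , 0ℤ , 0ℤ ⟩
  e₂ = ⟨ 0ℤ , + 1 , 0ℤ , 0ℤ ⟩
  e₃ = ⟨ 0ℤ , 0ℤ , + 1 , 0ℤ ⟩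
  e₄ = ⟨ 0ℤ , 0ℤ , 0ℤ , + 1 ⟩

  combine : Q4 → Q4 → Q4 → Q4 → Q4 → Q4
  combine v u₁ u₂ u₃ u₄ = X v ⊙ u₁ ⊕ Y v ⊙ u₂ ⊕ P v ⊙ u₃ ⊕ Q v ⊙ u₄

  combine-basis : ∀ v → v ≡ combine v e₁ e₂ e₃ e₄
  combine-basis ⟨ x , y , p , q ⟩ = ⟨⟩-cong (coord₁ x y p q) (coord₂ x y p q) (coord₃ x y p q) (coord₄ x y p q)
    where
    coord₁ : ∀ x y p q → x ≡ x * + 1 + (y * 0ℤ + (p * 0ℤ + q * 0ℤ))
    coord₁ = solve-∀
    coord₂ : ∀ x y p q → y ≡ x * 0ℤ + (y * + 1 + (p * 0ℤ + q * 0ℤ))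
    coord₂ = solve-∀
    coord₃ : ∀ x y p q → p ≡ x * 0ℤ + (y * 0ℤ + (p * + 1 + q * 0ℤ))
    coord₃ = solve-∀
    coord₄ : ∀ x y p q → q ≡ x * 0ℤ + (y * 0ℤ + (p * 0ℤ + q * + 1))
    coord₄ = solve-∀

  act₂-combine : ∀ A B w v u₁ u₂ u₃ u₄ →
                act₂ A B w (combine v u₁ u₂ u₃ u₄) ≡ combine v (act₂ A B w u₁) (act₂ A B w u₂) (act₂ A B w u₃) (act₂ A B w u₄)
  act₂-combine A B w v u₁ u₂ u₃ u₄ = begin
    act₂ A B w (X v ⊙ u₁ ⊕ Y v ⊙ u₂ ⊕ P v ⊙ u₃ ⊕ Q v ⊙ u₄)
      ≡⟨ act₂-⊕ A B w (X v ⊙ u₁) (Y v ⊙ u₂ ⊕ P v ⊙ u₃ ⊕ Q v ⊙ u₄) ⟩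
    act₂ A B w (X v ⊙ u₁) ⊕ act₂ A B w (Y v ⊙ u₂ ⊕ P v ⊙ u₃ ⊕ Q v ⊙ u₄)
      ≡⟨ cong₂ _⊕_ (act₂-⊙ A B w (X v) u₁) (act₂-⊕ A B w (Y v ⊙ u₂) (P v ⊙ u₃ ⊕ Q v ⊙ u₄)) ⟩
    X v ⊙ act₂ A B w u₁ ⊕ act₂ A B w (Y v ⊙ u₂) ⊕ act₂ A B w (P v ⊙ u₃ ⊕ Q v ⊙ u₄)
      ≡⟨ cong (λ z → X v ⊙ act₂ A B w u₁ ⊕ z) (cong₂ _⊕_ (act₂-⊙ A B w (Y v) u₂) (act₂-⊕ A B w (P v ⊙ u₃) (Q v ⊙ u₄))) ⟩
    X v ⊙ act₂ A B w u₁ ⊕ Y v ⊙ act₂ A B w u₂ ⊕ act₂ A B w (P v ⊙ u₃) ⊕ act₂ A B w (Q v ⊙ u₄)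
      ≡⟨ cong (λ z → X v ⊙ act₂ A B w u₁ ⊕ Y v ⊙ act₂ A B w u₂ ⊕ z)
              (cong₂ _⊕_ (act₂-⊙ A B w (P v) u₃) (act₂-⊙ A B w (Q v) u₄)) ⟩
    combine v (act₂ A B w u₁) (act₂ A B w u₂) (act₂ A B w u₃) (act₂ A B w u₄) ∎
    where open ≡-Reasoning

  SameAct₂ : ℤ → ℤ → List Gen₂ → List Gen₂ → Set
  SameAct₂ A B w w′ = ∀ v → act₂ A B w v ≡ act₂ A B w′ v

  -- by linearity it suffices to compare the images of the standard basis
  sameAct₂? : ∀ A B w w′ → Dec (SameAct₂ A B w w′)
  sameAct₂? A B w w′ = map′ on-basis (λ same → same e₁ , same e₂ , same e₃ , same e₄)
    (act₂ A B w e₁ ≟Q4 act₂ A B w′ e₁ ×-dec act₂ A B w e₂ ≟Q4 act₂ A B w′ e₂ ×-dec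
     act₂ A B w e₃ ≟Q4 act₂ A B w′ e₃ ×-dec act₂ A B w e₄ ≟Q4 act₂ A B w′ e₄)
    where
    on-basis : _ → SameAct₂ A B w w′
    on-basis (eq₁ , eq₂ , eq₃ , eq₄) v = begin
      act₂ A B w v
        ≡⟨ cong (act₂ A B w) (combine-basis v) ⟩
      act₂ A B w (combine v e₁ e₂ e₃ e₄)
        ≡⟨ act₂-combine A B w v e₁ e₂ e₃ e₄ ⟩
      combine v (act₂ A B w e₁) (act₂ A B w e₂) (act₂ A B w e₃) (act₂ A B w e₄)
        ≡⟨ cong₂ (λ u₁ u₂ → combine v u₁ u₂ _ _) eq₁ eq₂ ⟩
      combine v (act₂ A B w′ e₁) (act₂ A B w′ e₂) (act₂ A B w e₃) (act₂ A B w e₄)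
        ≡⟨ cong₂ (combine v _ _) eq₃ eq₄ ⟩
      combine v (act₂ A B w′ e₁) (act₂ A B w′ e₂) (act₂ A B w′ e₃) (act₂ A B w′ e₄)
        ≡⟨ act₂-combine A B w′ v e₁ e₂ e₃ e₄ ⟨
      act₂ A B w′ (combine v e₁ e₂ e₃ e₄)
        ≡⟨ cong (act₂ A B w′) (combine-basis v) ⟨
      act₂ A B w′ v
        ∎
      where open ≡-Reasoning

  PositiveXY : Q4 → Set
  PositiveXY v = 0ℤ ℤ.≤ X v × 0ℤ ℤ.≤ Y v

  -- ⟨ 1 , 0 , a s s , a s t ⟩ for x = α_s
  αₛ : ℤ → Q4
  αₛ A = ⟨ + 1 , 0ℤ , + 2 , A ⟩

  ShorterPositive : ℤ → ℤ → ℕ → Set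
  ShorterPositive A B m = ∀ c (n : Fin m) →
    EndsWithS (alternating c (toℕ n)) ⊎ PositiveXY (act₂ A B (alternating c (toℕ n)) (αₛ A))

  shorterPositive? : ∀ A B m → Dec (ShorterPositive A B m)
  shorterPositive? A B m = map′ (λ (forS , forT) → λ { S → forS ; T → forT }) (λ all → all S , all T)
                                (Finₚ.all? {n = m} (check S) ×-dec Finₚ.all? {n = m} (check T))
    where
    check : ∀ c (n : Fin m) → Dec (EndsWithS (alternating c (toℕ n)) ⊎ PositiveXY (act₂ A B (alternating c (toℕ n)) (αₛ A)))
    check c n = endsWithS? _ ⊎-dec (0ℤ ℤ.≤? _ ×-dec 0ℤ ℤ.≤? _)

  -- m is the order of s_s s_t; for each rank-two type the fields are checked by evaluation.
  record FiniteDihedral (A B : ℤ) : Set where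
    field
      m                : ℕ
      braid            : SameAct₂ A B (alternating S m) (alternating T m)
      longest-endsWithS : EndsWithS (alternating S m) ⊎ EndsWithS (alternating T m)
      shorter-positive : ShorterPositive A B m

  finiteDihedral : ∀ {A B} m →
    {True (sameAct₂? A B (alternating S m) (alternating T m))} →
    {True (endsWithS? (alternating S m) ⊎-dec endsWithS? (alternating T m))} →
    {True (shorterPositive? A B m)} → FiniteDihedral A B
  finiteDihedral m {braid} {ends} {positive} =
    record { m = m ; braid = toWitness braid ; longest-endsWithS = toWitness ends ; shorter-positive = toWitness positive }

  data RankTwoType : ℤ → ℤ → Set where
    A₁×A₁ : RankTwoType 0ℤ 0ℤ
    A₂    : RankTwoType -[1+ 0 ] -[1+ 0 ]
    B₂    : RankTwoType -[1+ 0 ] -[1+ 1 ]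
    C₂    : RankTwoType -[1+ 1 ] -[1+ 0 ]
    G₂    : RankTwoType -[1+ 0 ] -[1+ 2 ]
    G₂ᵀ   : RankTwoType -[1+ 2 ] -[1+ 0 ]

  rankTwoType : ∀ A B → A ℤ.≤ 0ℤ → B ℤ.≤ 0ℤ → (A ≡ 0ℤ → B ≡ 0ℤ) → (B ≡ 0ℤ → A ≡ 0ℤ) → A * B ℤ.< + 4 →
                RankTwoType A B
  rankTwoType (+ zero)  B        _        _        A≡0⇒B≡0 _ _ rewrite A≡0⇒B≡0 refl = A₁×A₁
  rankTwoType +[1+ _ ]  B        (+≤+ ()) _        _ _ _
  rankTwoType -[1+ _ ]  (+ zero) _        _        _ B≡0⇒A≡0 _ with () ← B≡0⇒A≡0 refl
  rankTwoType -[1+ _ ]  +[1+ _ ] _        (+≤+ ()) _ _ _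
  rankTwoType -[1+ m ]  -[1+ n ] _        _        _ _ (ℤ.+<+ mn<4) = negative m n mn<4
    where
    negative : ∀ m n → suc m ℕ.* suc n < 4 → RankTwoType -[1+ m ] -[1+ n ]
    negative 0 0 _ = A₂
    negative 0 1 _ = B₂
    negative 1 0 _ = C₂
    negative 0 2 _ = G₂
    negative 2 0 _ = G₂ᵀ
    negative 0 (suc (suc (suc _))) (s≤s (s≤s (s≤s (s≤s ()))))
    negative (suc (suc (suc m))) 0 mn<4 with () ← ℕₚ.<⇒≱ mn<4
      (ℕₚ.≤-trans (s≤s (s≤s (s≤s (s≤s z≤n)))) (ℕₚ.≤-reflexive (sym (ℕₚ.*-identityʳ (4 ℕ.+ m)))))
    negative (suc m) (suc n) mn<4 with () ← ℕₚ.<⇒≱ mn<4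
      (ℕₚ.*-mono-≤ {2} {suc (suc m)} {2} {suc (suc n)} (s≤s (s≤s z≤n)) (s≤s (s≤s z≤n)))

  finiteDihedral-of : ∀ {A B} → RankTwoType A B → FiniteDihedral A B
  finiteDihedral-of A₁×A₁ = finiteDihedral 2
  finiteDihedral-of A₂    = finiteDihedral 3
  finiteDihedral-of B₂    = finiteDihedral 4
  finiteDihedral-of C₂    = finiteDihedral 4
  finiteDihedral-of G₂    = finiteDihedral 6
  finiteDihedral-of G₂ᵀ   = finiteDihedral 6


module Reflections {r : ℕ} (R : CartanData r) where

  open CartanData R

  V : Set
  V = Fin r → ℤ

  α∨ : Fin r → V → ℤ
  α∨ i x = sumFin r (λ j → x j * a j i)

  reflect : Fin r → V → V
  reflect = Defs.refl R

  α : Fin r → V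
  α i k with k ≟ i
  ... | yes _ = + 1
  ... | no  _ = 0ℤ

  α-≡ : ∀ i → α i i ≡ + 1
  α-≡ i with i ≟ i
  ... | yes _  = refl
  ... | no i≢i = ⊥-elim (i≢i refl)

  α-≢ : ∀ {i k} → k ≢ i → α i k ≡ 0ℤ
  α-≢ {i} {k} k≢i with k ≟ i
  ... | yes k≡i = ⊥-elim (k≢i k≡i)
  ... | no  _   = refl

  Nonneg : V → Set
  Nonneg x = ∀ k → 0ℤ ℤ.≤ x k

  nonneg? : ∀ x → Dec (Nonneg x)
  nonneg? x = Finₚ.all? (λ k → 0ℤ ℤ.≤? x k)

  α-nonneg : ∀ i → Nonneg (α i)
  α-nonneg i k with k ≟ i
  ... | yes _ = +≤+ ℕ.z≤n
  ... | no  _ = ℤₚ.≤-refl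

  reflect-≡ : ∀ i x → reflect i x i ≡ x i - α∨ i x
  reflect-≡ i x with i ≟ i
  ... | yes _  = refl
  ... | no i≢i = ⊥-elim (i≢i refl)

  reflect-≢ : ∀ {i k} x → k ≢ i → reflect i x k ≡ x k
  reflect-≢ {i} {k} x k≢i with k ≟ i
  ... | yes k≡i = ⊥-elim (k≢i k≡i)
  ... | no  _   = refl

  reflect-≡-at-zero : ∀ {i} x → x i ≡ 0ℤ → reflect i x i ≡ - α∨ i x
  reflect-≡-at-zero {i} x xi≡0 = trans (reflect-≡ i x) (trans (cong (_- α∨ i x) xi≡0) (ℤₚ.+-identityˡ (- α∨ i x)))

  α∨-cong : ∀ i {x y} → x ≗ y → α∨ i x ≡ α∨ i y
  α∨-cong i x≗y = sumFin-cong r (λ j → cong (_* a j i) (x≗y j))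

  reflect-cong : ∀ i {x y} → x ≗ y → reflect i x ≗ reflect i y
  reflect-cong i {x} {y} x≗y k with toSum (k ≟ i)
  ... | inj₁ refl = trans (reflect-≡ i x) (trans (cong₂ _-_ (x≗y i) (α∨-cong i x≗y)) (sym (reflect-≡ i y)))
  ... | inj₂ k≢i  = trans (reflect-≢ x k≢i) (trans (x≗y k) (sym (reflect-≢ y k≢i)))

  linComb : ℤ → V → ℤ → V → V
  linComb c x d y k = c * x k + d * y k

  linComb-nonneg : ∀ c x d y → 0ℤ ℤ.≤ c → 0ℤ ℤ.≤ d → Nonneg x → Nonneg y → Nonneg (linComb c x d y)
  linComb-nonneg c x d y 0≤c 0≤d x≥0 y≥0 k =
    ℤₚ.+-mono-≤ (*-nonNeg-nonNeg c (x k) 0≤c (x≥0 k)) (*-nonNeg-nonNeg d (y k) 0≤d (y≥0 k))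

  α∨-linComb : ∀ i c x d y → α∨ i (linComb c x d y) ≡ c * α∨ i x + d * α∨ i y
  α∨-linComb i c x d y = begin
    sumFin r (λ j → (c * x j + d * y j) * a j i)
      ≡⟨ sumFin-cong r (λ j → distrib c (x j) d (y j) (a j i)) ⟩
    sumFin r (λ j → c * (x j * a j i) + d * (y j * a j i))
      ≡⟨ sumFin-+ r _ _ ⟩
    sumFin r (λ j → c * (x j * a j i)) + sumFin r (λ j → d * (y j * a j i))
      ≡⟨ cong₂ _+_ (sumFin-*ˡ r c _) (sumFin-*ˡ r d _) ⟩
    c * α∨ i x + d * α∨ i y ∎
    where
    open ≡-Reasoning
    distrib : ∀ c x d y b → (c * x + d * y) * b ≡ c * (x * b) + d * (y * b)
    distrib = solve-∀

  reflect-linComb : ∀ i c x d y → reflect i (linComb c x d y) ≗ linComb c (reflect i x) d (reflect i y)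
  reflect-linComb i c x d y k with toSum (k ≟ i)
  ... | inj₂ k≢i = trans (reflect-≢ _ k≢i) (sym (cong₂ (λ u v → c * u + d * v) (reflect-≢ x k≢i) (reflect-≢ y k≢i)))
  ... | inj₁ refl = begin
    reflect i (linComb c x d y) i                  ≡⟨ reflect-≡ i _ ⟩
    (c * x i + d * y i) - α∨ i (linComb c x d y)   ≡⟨ cong (_-_ (c * x i + d * y i)) (α∨-linComb i c x d y) ⟩
    (c * x i + d * y i) - (c * α∨ i x + d * α∨ i y) ≡⟨ distrib c (x i) d (y i) (α∨ i x) (α∨ i y) ⟩
    c * (x i - α∨ i x) + d * (y i - α∨ i y)        ≡⟨ cong₂ (λ u v → c * u + d * v) (reflect-≡ i x) (reflect-≡ i y) ⟨
    c * reflect i x i + d * reflect i y i          ∎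
    where
    open ≡-Reasoning
    distrib : ∀ c x d y p q → (c * x + d * y) - (c * p + d * q) ≡ c * (x - p) + d * (y - q)
    distrib = solve-∀

  α∨-α : ∀ t s → α∨ t (α s) ≡ a s t
  α∨-α t s = begin
    α∨ t (α s)      ≡⟨ sumFin-single r _ s (λ j j≢s → trans (cong (_* a j t) (α-≢ j≢s)) (ℤₚ.*-zeroˡ (a j t))) ⟩
    α s s * a s t   ≡⟨ cong (_* a s t) (α-≡ s) ⟩
    + 1 * a s t     ≡⟨ ℤₚ.*-identityˡ _ ⟩
    a s t           ∎
    where open ≡-Reasoning

  reflect-linComb-α : ∀ i x → reflect i x ≗ linComb (+ 1) x (- α∨ i x) (α i)
  reflect-linComb-α i x k with toSum (k ≟ i)
  ... | inj₁ refl = begin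
    reflect i x i                          ≡⟨ reflect-≡ i x ⟩
    x i - α∨ i x                           ≡⟨ lemma (x i) (α∨ i x) ⟨
    + 1 * x i + - α∨ i x * + 1             ≡⟨ cong (λ z → + 1 * x i + - α∨ i x * z) (α-≡ i) ⟨
    + 1 * x i + - α∨ i x * α i i           ∎
    where
    open ≡-Reasoning
    lemma : ∀ u p → + 1 * u + - p * + 1 ≡ u - p
    lemma = solve-∀
  ... | inj₂ k≢i = begin
    reflect i x k                          ≡⟨ reflect-≢ x k≢i ⟩
    x k                                    ≡⟨ lemma (x k) (α∨ i x) ⟨
    + 1 * x k + - α∨ i x * 0ℤ              ≡⟨ cong (λ z → + 1 * x k + - α∨ i x * z) (α-≢ k≢i) ⟨
    + 1 * x k + - α∨ i x * α i k           ∎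
    where
    open ≡-Reasoning
    lemma : ∀ u p → + 1 * u + - p * 0ℤ ≡ u
    lemma = solve-∀

  α∨-reflect : ∀ t s x → α∨ t (reflect s x) ≡ α∨ t x - α∨ s x * a s t
  α∨-reflect t s x = begin
    α∨ t (reflect s x)                            ≡⟨ α∨-cong t (reflect-linComb-α s x) ⟩
    α∨ t (linComb (+ 1) x (- α∨ s x) (α s))       ≡⟨ α∨-linComb t (+ 1) x (- α∨ s x) (α s) ⟩
    + 1 * α∨ t x + - α∨ s x * α∨ t (α s)          ≡⟨ cong (λ z → + 1 * α∨ t x + - α∨ s x * z) (α∨-α t s) ⟩
    + 1 * α∨ t x + - α∨ s x * a s t               ≡⟨ lemma (α∨ t x) (α∨ s x) (a s t) ⟩
    α∨ t x - α∨ s x * a s t                       ∎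
    where
    open ≡-Reasoning
    lemma : ∀ u p b → + 1 * u + - p * b ≡ u - p * b
    lemma = solve-∀

  reflect-involutive : ∀ i x → reflect i (reflect i x) ≗ x
  reflect-involutive i x k with toSum (k ≟ i)
  ... | inj₂ k≢i = trans (reflect-≢ _ k≢i) (reflect-≢ x k≢i)
  ... | inj₁ refl = begin
    reflect i (reflect i x) i                           ≡⟨ reflect-≡ i _ ⟩
    reflect i x i - α∨ i (reflect i x)                  ≡⟨ cong₂ _-_ (reflect-≡ i x) (α∨-reflect i i x) ⟩
    (x i - α∨ i x) - (α∨ i x - α∨ i x * a i i)          ≡⟨ cong (λ z → (x i - α∨ i x) - (α∨ i x - α∨ i x * z)) (diag i) ⟩
    (x i - α∨ i x) - (α∨ i x - α∨ i x * + 2)            ≡⟨ lemma (x i) (α∨ i x) ⟩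
    x i                                                 ∎
    where
    open ≡-Reasoning
    lemma : ∀ u p → (u - p) - (p - p * + 2) ≡ u
    lemma = solve-∀

  reflect-comm-at : ∀ {s t} → s ≢ t → a t s ≡ 0ℤ → ∀ x → reflect s (reflect t x) s ≡ reflect t (reflect s x) s
  reflect-comm-at {s} {t} s≢t ats≡0 x = begin
    reflect s (reflect t x) s                   ≡⟨ reflect-≡ s _ ⟩
    reflect t x s - α∨ s (reflect t x)          ≡⟨ cong₂ _-_ (reflect-≢ x s≢t) (α∨-reflect s t x) ⟩
    x s - (α∨ s x - α∨ t x * a t s)             ≡⟨ cong (λ z → x s - (α∨ s x - α∨ t x * z)) ats≡0 ⟩
    x s - (α∨ s x - α∨ t x * 0ℤ)                ≡⟨ cong (λ z → x s - (α∨ s x - z)) (ℤₚ.*-zeroʳ (α∨ t x)) ⟩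
    x s - (α∨ s x - 0ℤ)                         ≡⟨ cong (_-_ (x s)) (ℤₚ.+-identityʳ _) ⟩
    x s - α∨ s x                                ≡⟨ reflect-≡ s x ⟨
    reflect s x s                               ≡⟨ reflect-≢ _ s≢t ⟨
    reflect t (reflect s x) s                   ∎
    where open ≡-Reasoning

  reflect-comm : ∀ {s t} → s ≢ t → a s t ≡ 0ℤ → a t s ≡ 0ℤ →
                 ∀ x → reflect s (reflect t x) ≗ reflect t (reflect s x)
  reflect-comm {s} {t} s≢t ast≡0 ats≡0 x k with toSum (k ≟ s) | toSum (k ≟ t)
  ... | inj₁ refl | inj₁ refl = ⊥-elim (s≢t refl)
  ... | inj₁ refl | inj₂ _    = reflect-comm-at s≢t ats≡0 x
  ... | inj₂ _    | inj₁ refl = sym (reflect-comm-at (s≢t ∘ sym) ast≡0 x)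
  ... | inj₂ k≢s  | inj₂ k≢t  =
    trans (reflect-≢ _ k≢s) (trans (reflect-≢ x k≢t) (sym (trans (reflect-≢ _ k≢t) (reflect-≢ x k≢s))))

  linComb-α-at-s : ∀ {s t} c d → s ≢ t → linComb c (α s) d (α t) s ≡ c
  linComb-α-at-s {s} {t} c d s≢t = trans (cong₂ (λ u v → c * u + d * v) (α-≡ s) (α-≢ s≢t)) (lemma c d)
    where
    lemma : ∀ c d → c * + 1 + d * 0ℤ ≡ c
    lemma = solve-∀

  linComb-α-at-t : ∀ {s t} c d → s ≢ t → linComb c (α s) d (α t) t ≡ d
  linComb-α-at-t {s} {t} c d s≢t = trans (cong₂ (λ u v → c * u + d * v) (α-≢ (s≢t ∘ sym)) (α-≡ t)) (lemma c d)
    where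
    lemma : ∀ c d → c * 0ℤ + d * + 1 ≡ d
    lemma = solve-∀

  linComb-α-elsewhere : ∀ {s t j} c d → j ≢ s → j ≢ t → linComb c (α s) d (α t) j ≡ 0ℤ
  linComb-α-elsewhere {s} {t} c d j≢s j≢t = trans (cong₂ (λ u v → c * u + d * v) (α-≢ j≢s) (α-≢ j≢t)) (lemma c d)
    where
    lemma : ∀ c d → c * 0ℤ + d * 0ℤ ≡ 0ℤ
    lemma = solve-∀

  linComb-α-pair : ∀ {s t} → s ≢ t → ∀ u → (∀ j → j ≢ s → j ≢ t → u j ≡ 0ℤ) → u ≗ linComb (u s) (α s) (u t) (α t)
  linComb-α-pair {s} {t} s≢t u u≡0 k with toSum (k ≟ s) | toSum (k ≟ t)
  ... | inj₁ refl | _         = sym (linComb-α-at-s (u s) (u t) s≢t)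
  ... | inj₂ _    | inj₁ refl = sym (linComb-α-at-t (u s) (u t) s≢t)
  ... | inj₂ k≢s  | inj₂ k≢t  = trans (u≡0 k k≢s k≢t) (sym (linComb-α-elsewhere (u s) (u t) k≢s k≢t))


module Words {r : ℕ} (R : CartanData r) where

  open Reflections R

  act-cong : ∀ w {x y} → x ≗ y → act R w x ≗ act R w y
  act-cong []      x≗y = x≗y
  act-cong (i ∷ w) x≗y = reflect-cong i (act-cong w x≗y)

  act-++ : ∀ p q x → act R (p ++ q) x ≗ act R p (act R q x)
  act-++ []      q x k = refl
  act-++ (i ∷ p) q x   = reflect-cong i (act-++ p q x)

  act-linComb : ∀ w c x d y → act R w (linComb c x d y) ≗ linComb c (act R w x) d (act R w y)
  act-linComb []      c x d y k = refl
  act-linComb (i ∷ w) c x d y k =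
    trans (reflect-cong i (act-linComb w c x d y) k) (reflect-linComb i c _ d _ k)

  act-∉ : ∀ {l} w x → l ∉ w → act R w x l ≡ x l
  act-∉ []      x l∉w = refl
  act-∉ (i ∷ w) x l∉w = trans (reflect-≢ _ (l∉w ∘ here)) (act-∉ w x (l∉w ∘ there))

  act-reverse-inverseˡ : ∀ w x → act R (reverse w) (act R w x) ≗ x
  act-reverse-inverseˡ []      x k = refl
  act-reverse-inverseˡ (i ∷ w) x k = begin
    act R (reverse (i ∷ w)) (act R (i ∷ w) x) k              ≡⟨ cong (λ v → act R v (act R (i ∷ w) x) k) (Listₚ.unfold-reverse i w) ⟩
    act R (reverse w ++ [ i ]) (reflect i (act R w x)) k     ≡⟨ act-++ (reverse w) [ i ] _ k ⟩
    act R (reverse w) (reflect i (reflect i (act R w x))) k  ≡⟨ act-cong (reverse w) (reflect-involutive i _) k ⟩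
    act R (reverse w) (act R w x) k                          ≡⟨ act-reverse-inverseˡ w x k ⟩
    x k                                                      ∎
    where open ≡-Reasoning

  act-reverse-inverseʳ : ∀ w x → act R w (act R (reverse w) x) ≗ x
  act-reverse-inverseʳ w x k =
    subst (λ v → act R v (act R (reverse w) x) k ≡ x k) (Listₚ.reverse-involutive w)
          (act-reverse-inverseˡ (reverse w) x k)

  -- A wrapper around Defs._≈_, so that the two words can be inferred from the type.
  infix 4 _∼_
  record _∼_ (u v : Word R) : Set where
    constructor ≈⇒∼
    field ∼⇒≈ : _≈_ R u v
  open _∼_ public

  ∼-refl : ∀ {w} → w ∼ w
  ∼-refl = ≈⇒∼ λ x k → refl

  ∼-sym : ∀ {u v} → u ∼ v → v ∼ u
  ∼-sym (≈⇒∼ u≈v) = ≈⇒∼ λ x k → sym (u≈v x k)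

  ∼-trans : ∀ {u v w} → u ∼ v → v ∼ w → u ∼ w
  ∼-trans (≈⇒∼ u≈v) (≈⇒∼ v≈w) = ≈⇒∼ λ x k → trans (u≈v x k) (v≈w x k)

  ∼-isEquivalence : IsEquivalence _∼_
  ∼-isEquivalence = record { refl = ∼-refl ; sym = ∼-sym ; trans = ∼-trans }

  ∼-setoid : Setoid _ _
  ∼-setoid = record { isEquivalence = ∼-isEquivalence }

  ≡⇒∼ : ∀ {u v} → u ≡ v → u ∼ v
  ≡⇒∼ refl = ∼-refl

  ++-cong : ∀ {p p′ q q′} → p ∼ p′ → q ∼ q′ → p ++ q ∼ p′ ++ q′
  ++-cong {p} {p′} {q} {q′} (≈⇒∼ p≈p′) (≈⇒∼ q≈q′) = ≈⇒∼ λ x k → begin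
    act R (p ++ q) x k      ≡⟨ act-++ p q x k ⟩
    act R p (act R q x) k   ≡⟨ act-cong p (q≈q′ x) k ⟩
    act R p (act R q′ x) k  ≡⟨ p≈p′ _ k ⟩
    act R p′ (act R q′ x) k ≡⟨ act-++ p′ q′ x k ⟨
    act R (p′ ++ q′) x k    ∎
    where open ≡-Reasoning

  ∷-cong : ∀ i {p q} → p ∼ q → i ∷ p ∼ i ∷ q
  ∷-cong i = ++-cong {[ i ]} ∼-refl

  ∷-cancel : ∀ i {p q} → i ∷ p ∼ i ∷ q → p ∼ q
  ∷-cancel i {p} {q} (≈⇒∼ ip≈iq) = ≈⇒∼ λ x k →
    trans (sym (reflect-involutive i (act R p x) k))
          (trans (reflect-cong i (ip≈iq x) k) (reflect-involutive i (act R q x) k))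

  reverse-cong : ∀ {p q} → p ∼ q → reverse p ∼ reverse q
  reverse-cong {p} {q} (≈⇒∼ p≈q) = ≈⇒∼ λ x k → begin
    act R (reverse p) x k                                  ≡⟨ act-cong (reverse p) (sym ∘ act-reverse-inverseʳ q x) k ⟩
    act R (reverse p) (act R q (act R (reverse q) x)) k    ≡⟨ act-cong (reverse p) (sym ∘ p≈q _) k ⟩
    act R (reverse p) (act R p (act R (reverse q) x)) k    ≡⟨ act-reverse-inverseˡ p _ k ⟩
    act R (reverse q) x k                                  ∎
    where open ≡-Reasoning

  ∷-∷-cancel : ∀ p i q → p ++ i ∷ i ∷ q ∼ p ++ q
  ∷-∷-cancel p i q = ++-cong {p} ∼-refl (≈⇒∼ λ x → reflect-involutive i (act R q x))

  reduced-≤ : ∀ {v w} → Reduced R w → v ∼ w → length w ≤ length v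
  reduced-≤ {v} w-red v∼w = w-red v (∼⇒≈ v∼w)

  reduced-length-≡ : ∀ {u v} → Reduced R u → Reduced R v → u ∼ v → length u ≡ length v
  reduced-length-≡ u-red v-red u∼v = ℕₚ.≤-antisym (reduced-≤ u-red (∼-sym u∼v)) (reduced-≤ v-red u∼v)

  reduced-resp : ∀ {v w} → Reduced R w → v ∼ w → length v ≡ length w → Reduced R v
  reduced-resp {v} w-red v∼w |v|≡|w| u u≈v =
    subst (_≤ length u) (sym |v|≡|w|) (reduced-≤ w-red (∼-trans (≈⇒∼ {u} u≈v) v∼w))

  reduced-++ˡ : ∀ p q → Reduced R (p ++ q) → Reduced R p
  reduced-++ˡ p q pq-red v v≈p = ℕₚ.+-cancelʳ-≤ (length q) (length p) (length v)
    (subst₂ _≤_ (Listₚ.length-++ p) (Listₚ.length-++ v) (reduced-≤ pq-red (++-cong (≈⇒∼ {v} {p} v≈p) (∼-refl {q}))))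

  reduced-++ʳ : ∀ p q → Reduced R (p ++ q) → Reduced R q
  reduced-++ʳ p q pq-red v v≈q = ℕₚ.+-cancelˡ-≤ (length p) (length q) (length v)
    (subst₂ _≤_ (Listₚ.length-++ p) (Listₚ.length-++ p) (reduced-≤ pq-red (++-cong (∼-refl {p}) (≈⇒∼ {v} {q} v≈q))))

  reduced-reverse : ∀ w → Reduced R w → Reduced R (reverse w)
  reduced-reverse w w-red v v≈w′ =
    subst₂ _≤_ (sym (Listₚ.length-reverse w)) (Listₚ.length-reverse v)
      (reduced-≤ w-red (subst (reverse v ∼_) (Listₚ.reverse-involutive w) (reverse-cong (≈⇒∼ {v} {reverse w} v≈w′))))

  RightAscent : Word R → Fin r → Set
  RightAscent w i = ∀ z → z ∼ w ++ [ i ] → length w ≤ length z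

  rightAscent-∼-shorter : ∀ {i} p q z → RightAscent (p ++ q) i → q ∼ z ++ [ i ] → length z < length q → ⊥
  rightAscent-∼-shorter {i} p q z ascent q∼zi |z|<|q| = ℕₚ.<⇒≱ |pz|<|pq| (ascent (p ++ z) pz∼pqi)
    where
    |pz|<|pq| : length (p ++ z) < length (p ++ q)
    |pz|<|pq| = subst₂ _<_ (sym (Listₚ.length-++ p)) (sym (Listₚ.length-++ p)) (ℕₚ.+-monoʳ-< (length p) |z|<|q|)
    pz∼pqi : p ++ z ∼ (p ++ q) ++ [ i ]
    pz∼pqi = begin
      p ++ z                     ≡⟨ Listₚ.++-identityʳ (p ++ z) ⟨
      (p ++ z) ++ []             ≈⟨ ∷-∷-cancel (p ++ z) i [] ⟨
      (p ++ z) ++ i ∷ i ∷ []     ≡⟨ Listₚ.++-assoc p z (i ∷ i ∷ []) ⟩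
      p ++ z ++ i ∷ i ∷ []       ≡⟨ cong (p ++_) (Listₚ.++-assoc z [ i ] [ i ]) ⟨
      p ++ (z ++ [ i ]) ++ [ i ] ≈⟨ ++-cong {p} ∼-refl (++-cong (∼-sym q∼zi) (∼-refl {[ i ]})) ⟩
      p ++ q ++ [ i ]            ≡⟨ Listₚ.++-assoc p q [ i ] ⟨
      (p ++ q) ++ [ i ]          ∎
      where open SetoidReasoning ∼-setoid

  ¬reduced-∷-∷ : ∀ i w → ¬ Reduced R (i ∷ i ∷ w)
  ¬reduced-∷-∷ i w red = ℕₚ.<⇒≱ (ℕₚ.m<n⇒m<1+n (ℕₚ.n<1+n (length w))) (reduced-≤ red (∼-sym (∷-∷-cancel [] i w)))


module Dihedral {r : ℕ} (R : CartanData r) where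

  open Reflections R
  open Words R
  open RankTwo

  open CartanData R

  a-zero-sym : ∀ s t → a s t ≡ 0ℤ → a t s ≡ 0ℤ
  a-zero-sym s t ast≡0 = ℤₚ.*-cancelʳ-≡ (a t s) 0ℤ (+ d s) {{d-pos s}} (begin
    a t s * + d s   ≡⟨ symm s t ⟨
    a s t * + d t   ≡⟨ cong (_* + d t) ast≡0 ⟩
    0ℤ              ∎)
    where open ≡-Reasoning

  quadraticForm : V → ℤ
  quadraticForm x = sumFin r (λ i → sumFin r (λ j → x i * (a i j * + d j) * x j))

  quadraticForm-pair : ∀ {s t} x → s ≢ t → (∀ j → j ≢ s → j ≢ t → x j ≡ 0ℤ) →
    quadraticForm x ≡ (x s * (a s s * + d s) * x s + x s * (a s t * + d t) * x t)
                    + (x t * (a t s * + d s) * x s + x t * (a t t * + d t) * x t)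
  quadraticForm-pair {s} {t} x s≢t x≡0 =
    trans (sumFin-pair r _ s t s≢t (λ i i≢s i≢t → sumFin-zero r _ (λ j → cong (λ z → z * (a i j * + d j) * x j) (x≡0 i i≢s i≢t))))
          (cong₂ _+_ (row s) (row t))
    where
    row : ∀ i → sumFin r (λ j → x i * (a i j * + d j) * x j) ≡ x i * (a i s * + d s) * x s + x i * (a i t * + d t) * x t
    row i = sumFin-pair r _ s t s≢t (λ j j≢s j≢t → trans (cong (x i * (a i j * + d j) *_) (x≡0 j j≢s j≢t)) (ℤₚ.*-zeroʳ (x i * (a i j * + d j))))

  quadraticForm-rank-two : ∀ {s t} → s ≢ t →
    quadraticForm (linComb (- a t s) (α s) (+ 2) (α t)) ≡ + 2 * + d t * (+ 4 - a s t * a t s)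
  quadraticForm-rank-two {s} {t} s≢t = begin
    quadraticForm x
      ≡⟨ quadraticForm-pair x s≢t (λ j → linComb-α-elsewhere (- B) (+ 2)) ⟩
    (x s * (a s s * + d s) * x s + x s * (A * + d t) * x t) + (x t * (B * + d s) * x s + x t * (a t t * + d t) * x t)
      ≡⟨ cong₂ (λ u v → (u * (a s s * + d s) * u + u * (A * + d t) * v) + (v * (B * + d s) * u + v * (a t t * + d t) * v))
               (linComb-α-at-s (- B) (+ 2) s≢t) (linComb-α-at-t (- B) (+ 2) s≢t) ⟩
    ((- B) * (a s s * + d s) * (- B) + (- B) * (A * + d t) * + 2) + (+ 2 * (B * + d s) * (- B) + + 2 * (a t t * + d t) * + 2)
      ≡⟨ cong₂ (λ u v → ((- B) * (u * + d s) * (- B) + (- B) * (A * + d t) * + 2) + (+ 2 * (B * + d s) * (- B) + + 2 * (v * + d t) * + 2))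
               (diag s) (diag t) ⟩
    ((- B) * (+ 2 * + d s) * (- B) + (- B) * (A * + d t) * + 2) + (+ 2 * (B * + d s) * (- B) + + 2 * (+ 2 * + d t) * + 2)
      ≡⟨ expand A B (+ d s) (+ d t) ⟩
    + 2 * + d t * (+ 4 - A * B) ∎
    where
    open ≡-Reasoning
    A B : ℤ
    A = a s t
    B = a t s
    x : V
    x = linComb (- B) (α s) (+ 2) (α t)
    expand : ∀ A B Ds Dt → ((- B) * (+ 2 * Ds) * (- B) + (- B) * (A * Dt) * + 2) + (+ 2 * (B * Ds) * (- B) + + 2 * (+ 2 * Dt) * + 2)
                           ≡ + 2 * Dt * (+ 4 - A * B)
    expand = solve-∀

  cartan-product-<4 : ∀ {s t} → s ≢ t → a s t * a t s ℤ.< + 4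
  cartan-product-<4 {s} {t} s≢t with + 4 ℤ.≤? a s t * a t s
  ... | no  4≰AB = ℤₚ.≰⇒> 4≰AB
  ... | yes 4≤AB = ⊥-elim (ℤₚ.<⇒≱ (posdef x (t , x-at-t≢0)) (subst (ℤ._≤ 0ℤ) (sym (quadraticForm-rank-two s≢t)) nonpos))
    where
    x : V
    x = linComb (- a t s) (α s) (+ 2) (α t)
    x-at-t≢0 : x t ≢ 0ℤ
    x-at-t≢0 xt≡0 with trans (sym (linComb-α-at-t (- a t s) (+ 2) s≢t)) xt≡0
    ... | ()
    nonpos : + 2 * + d t * (+ 4 - a s t * a t s) ℤ.≤ 0ℤ
    nonpos = *-nonNeg-nonPos (+ 2 * + d t) _ (*-nonNeg-nonNeg (+ 2) (+ d t) (+≤+ z≤n) (+≤+ z≤n)) (ℤₚ.i≤j⇒i-j≤0 4≤AB)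

  rankTwoType-of : ∀ {s t} → s ≢ t → RankTwoType (a s t) (a t s)
  rankTwoType-of {s} {t} s≢t = rankTwoType (a s t) (a t s) (offdiag s t s≢t) (offdiag t s (s≢t ∘ sym))
                                           (a-zero-sym s t) (a-zero-sym t s) (cartan-product-<4 s≢t)

  module _ {s t : Fin r} (s≢t : s ≢ t) where

    private
      A B : ℤ
      A = a s t
      B = a t s
      t≢s : t ≢ s
      t≢s = s≢t ∘ sym

    embed : Gen₂ → Fin r
    embed S = s
    embed T = t

    track : V → Q4
    track x = ⟨ x s , x t , α∨ s x , α∨ t x ⟩

    track-reflect : ∀ c x → track (reflect (embed c) x) ≡ reflect₂ A B c (track x)
    track-reflect S x = ⟨⟩-cong (reflect-≡ s x) (reflect-≢ x t≢s)
      (trans (α∨-reflect s s x) (cong (λ z → α∨ s x - α∨ s x * z) (diag s))) (α∨-reflect t s x)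
    track-reflect T x = ⟨⟩-cong (reflect-≢ x s≢t) (reflect-≡ t x)
      (α∨-reflect s t x) (trans (α∨-reflect t t x) (cong (λ z → α∨ t x - α∨ t x * z) (diag t)))

    track-act : ∀ w x → track (act R (map embed w) x) ≡ act₂ A B w (track x)
    track-act []      x = refl
    track-act (c ∷ w) x = trans (track-reflect c _) (cong (reflect₂ A B c) (track-act w x))

    track-α : track (α s) ≡ αₛ A
    track-α = ⟨⟩-cong (α-≡ s) (α-≢ t≢s) (trans (α∨-α s s) (diag s)) (α∨-α t s)

    act-embed-other : ∀ {k} w x → k ≢ s → k ≢ t → act R (map embed w) x k ≡ x k
    act-embed-other {k} w x k≢s k≢t = act-∉ (map embed w) x (k∉ w)
      where
      k∉ : ∀ w → k ∉ map embed w
      k∉ (S ∷ w) (here k≡s) = k≢s k≡s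
      k∉ (T ∷ w) (here k≡t) = k≢t k≡t
      k∉ (_ ∷ w) (there k∈) = k∉ w k∈

    sameAct₂⇒∼ : ∀ {u v} → SameAct₂ A B u v → map embed u ∼ map embed v
    sameAct₂⇒∼ {u} {v} same = ≈⇒∼ λ x k → on k x
      where
      on : ∀ k x → act R (map embed u) x k ≡ act R (map embed v) x k
      on k x with toSum (k ≟ s) | toSum (k ≟ t)
      ... | inj₁ refl | _         = cong X (trans (track-act u x) (trans (same (track x)) (sym (track-act v x))))
      ... | inj₂ _    | inj₁ refl = cong Y (trans (track-act u x) (trans (same (track x)) (sym (track-act v x))))
      ... | inj₂ k≢s  | inj₂ k≢t  = trans (act-embed-other u x k≢s k≢t) (sym (act-embed-other v x k≢s k≢t))

    reduced⇒alternating : ∀ c w → Reduced R (map embed (c ∷ w)) → c ∷ w ≡ alternating c (suc (length w))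
    reduced⇒alternating c []      _   = refl
    reduced⇒alternating S (S ∷ w) red = ⊥-elim (¬reduced-∷-∷ s (map embed w) red)
    reduced⇒alternating T (T ∷ w) red = ⊥-elim (¬reduced-∷-∷ t (map embed w) red)
    reduced⇒alternating S (T ∷ w) red = cong (S ∷_) (reduced⇒alternating T w (reduced-++ʳ [ s ] (map embed (T ∷ w)) red))
    reduced⇒alternating T (S ∷ w) red = cong (T ∷_) (reduced⇒alternating S w (reduced-++ʳ [ t ] (map embed (S ∷ w)) red))

    tracked : ∀ {w} → track (act R (map embed w) (α s)) ≡ act₂ A B w (αₛ A)
    tracked {w} = trans (track-act w (α s)) (cong (act₂ A B w) track-α)

    positiveXY⇒nonneg : ∀ w → PositiveXY (act₂ A B w (αₛ A)) → Nonneg (act R (map embed w) (α s))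
    positiveXY⇒nonneg w (0≤X , 0≤Y) k with toSum (k ≟ s) | toSum (k ≟ t)
    ... | inj₁ refl | _         = subst (0ℤ ℤ.≤_) (sym (cong X (tracked {w}))) 0≤X
    ... | inj₂ _    | inj₁ refl = subst (0ℤ ℤ.≤_) (sym (cong Y (tracked {w}))) 0≤Y
    ... | inj₂ k≢s  | inj₂ k≢t  = subst (0ℤ ℤ.≤_) (sym (act-embed-other w (α s) k≢s k≢t)) (α-nonneg s k)

    endsWithS⇒∼ : ∀ {w pre} → w ≡ pre ++ [ S ] → map embed w ∼ map embed pre ++ [ s ]
    endsWithS⇒∼ {pre = pre} refl = ≡⇒∼ (Listₚ.map-++ embed pre [ S ])

    endsWithS-shorter : ∀ {w pre} → w ≡ pre ++ [ S ] → length (map embed pre) < length (map embed w)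
    endsWithS-shorter {pre = pre} refl rewrite Listₚ.length-map embed (pre ++ [ S ]) | Listₚ.length-++ pre {[ S ]}
      = subst (_< length pre ℕ.+ 1) (sym (Listₚ.length-map embed pre)) (ℕₚ.m<m+n (length pre) (s≤s z≤n))

    module _ (dihedral : FiniteDihedral A B) where
      open FiniteDihedral dihedral

      alternating-∼ : ∀ c c′ → map embed (alternating c m) ∼ map embed (alternating c′ m)
      alternating-∼ S S = ∼-refl
      alternating-∼ S T = sameAct₂⇒∼ braid
      alternating-∼ T S = ∼-sym (sameAct₂⇒∼ braid)
      alternating-∼ T T = ∼-refl

      same-length : ∀ c c′ → length (map embed (alternating c m)) ≡ length (map embed (alternating c′ m))
      same-length c c′ = begin
        length (map embed (alternating c m))  ≡⟨ Listₚ.length-map embed (alternating c m) ⟩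
        length (alternating c m)              ≡⟨ alternating-length c m ⟩
        m                                     ≡⟨ alternating-length c′ m ⟨
        length (alternating c′ m)             ≡⟨ Listₚ.length-map embed (alternating c′ m) ⟨
        length (map embed (alternating c′ m)) ∎
        where open ≡-Reasoning

      longest-∼-endsWithS : ∀ c → ∃ λ pre → map embed (alternating c m) ∼ map embed pre ++ [ s ]
                                           × length (map embed pre) < length (map embed (alternating c m))
      longest-∼-endsWithS c with longest-endsWithS
      ... | inj₁ (pre , eq) = pre , ∼-trans (alternating-∼ c S) (endsWithS⇒∼ eq)
                                  , subst (length (map embed pre) <_) (same-length S c) (endsWithS-shorter eq)
      ... | inj₂ (pre , eq) = pre , ∼-trans (alternating-∼ c T) (endsWithS⇒∼ eq)
                                  , subst (length (map embed pre) <_) (same-length T c) (endsWithS-shorter eq)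

      shorter-positive′ : ∀ c n → n < m →
        EndsWithS (alternating c n) ⊎ PositiveXY (act₂ A B (alternating c n) (αₛ A))
      shorter-positive′ c n n<m =
        subst (λ k → EndsWithS (alternating c k) ⊎ PositiveXY (act₂ A B (alternating c k) (αₛ A)))
              (Finₚ.toℕ-fromℕ< n<m) (shorter-positive c (fromℕ< n<m))

      -- An alternating word of length ≥ m ends in one side of the braid relation, whose other side ends in s.
      alternating-positive : ∀ c n → RightAscent (map embed (alternating c n)) s →
                             Nonneg (act R (map embed (alternating c n)) (α s))
      alternating-positive c n ascent with n <? m
      ... | yes n<m with shorter-positive′ c n n<m
      ...   | inj₁ (pre , eq) = ⊥-elim (rightAscent-∼-shorter [] _ (map embed pre) ascent (endsWithS⇒∼ eq) (endsWithS-shorter eq))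
      ...   | inj₂ positive   = positiveXY⇒nonneg (alternating c n) positive
      alternating-positive c n ascent | no n≮m
        with alternating-+ c (n ∸ m) m
      ... | c′ , split with longest-∼-endsWithS c′
      ...   | pre , ∼pre , shorter = ⊥-elim (rightAscent-∼-shorter (map embed (alternating c (n ∸ m))) _ (map embed pre) ascent′ ∼pre shorter)
        where
        n≡ : alternating c n ≡ alternating c (n ∸ m) ++ alternating c′ m
        n≡ = trans (cong (alternating c) (sym (ℕₚ.m∸n+n≡m (ℕₚ.≮⇒≥ n≮m)))) split
        ascent′ : RightAscent (map embed (alternating c (n ∸ m)) ++ map embed (alternating c′ m)) s
        ascent′ = subst (λ w → RightAscent w s) (trans (cong (map embed) n≡) (Listₚ.map-++ embed (alternating c (n ∸ m)) (alternating c′ m))) ascent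

    dihedral-positive : ∀ w → Reduced R (map embed w) → RightAscent (map embed w) s → Nonneg (act R (map embed w) (α s))
    dihedral-positive []      _   _      = α-nonneg s
    dihedral-positive (c ∷ w) red ascent =
      subst (λ u → RightAscent (map embed u) s → Nonneg (act R (map embed u) (α s)))
            (sym (reduced⇒alternating c w red))
            (alternating-positive (finiteDihedral-of (rankTwoType-of s≢t)) c (suc (length w))) ascent


module Positivity {r : ℕ} (R : CartanData r) where

  open Reflections R
  open Words R
  open Dihedral R
  open RankTwo using (Gen₂; S; T)

  module _ {s t : Fin r} (s≢t : s ≢ t) where

    record DihedralFactorisation (y : Word R) (k : ℕ) : Set where
      field
        prefix        : Word R
        suffix        : List Gen₂
        factorises    : prefix ++ map (embed s≢t) suffix ∼ y
        length-+      : length prefix ℕ.+ length suffix ≡ length y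
        prefix-length : length prefix ≡ k

    length-++-embed : ∀ z w → length (z ++ map (embed s≢t) w) ≡ length z ℕ.+ length w
    length-++-embed z w = trans (Listₚ.length-++ z) (cong (length z ℕ.+_) (Listₚ.length-map (embed s≢t) w))

    module LeastFactorisation {y} (y-red : Reduced R y) {k} (F : DihedralFactorisation y k)
                              (least : ∀ j → DihedralFactorisation y j → k ≤ j) where
      open DihedralFactorisation F renaming (prefix to v; suffix to w)

      private
        embedded : List Gen₂ → Word R
        embedded = map (embed s≢t)

        not-shorter : ∀ z → z ∼ y → ¬ length z < length y
        not-shorter z z∼y = ℕₚ.≤⇒≯ (reduced-≤ y-red z∼y)

      prefix-reduced : Reduced R v
      prefix-reduced z z≈v = ℕₚ.≮⇒≥ λ |z|<|v| → not-shorter (z ++ embedded w)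
        (∼-trans (++-cong (≈⇒∼ {z} z≈v) ∼-refl) factorises)
        (subst₂ _<_ (sym (length-++-embed z w)) length-+ (ℕₚ.+-monoˡ-< (length w) |z|<|v|))

      suffix-reduced : Reduced R (embedded w)
      suffix-reduced z z≈w = ℕₚ.≮⇒≥ λ |z|<|w| → not-shorter (v ++ z)
        (∼-trans (++-cong {v} ∼-refl (≈⇒∼ {z} z≈w)) factorises)
        (subst₂ _<_ (sym (Listₚ.length-++ v)) (trans (cong (length v ℕ.+_) (Listₚ.length-map (embed s≢t) w)) length-+)
                (ℕₚ.+-monoʳ-< (length v) |z|<|w|))

      prefix-ascent : ∀ c → RightAscent v (embed s≢t c)
      prefix-ascent c z z∼vc = ℕₚ.≮⇒≥ λ |z|<|v| → ℕₚ.<⇒≱ |z|<|v|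
        (subst (_≤ length z) (sym prefix-length) (least (length z) (shorter-factorisation |z|<|v|)))
        where
        i = embed s≢t c
        z-factorises : z ++ embedded (c ∷ w) ∼ y
        z-factorises = begin
          z ++ i ∷ embedded w                ≈⟨ ++-cong z∼vc (∼-refl {i ∷ embedded w}) ⟩
          (v ++ [ i ]) ++ i ∷ embedded w     ≡⟨ Listₚ.++-assoc v [ i ] (i ∷ embedded w) ⟩
          v ++ i ∷ i ∷ embedded w            ≈⟨ ∷-∷-cancel v i (embedded w) ⟩
          v ++ embedded w                    ≈⟨ factorises ⟩
          y                                  ∎
          where open SetoidReasoning ∼-setoid
        shorter-factorisation : length z < length v → DihedralFactorisation y (length z)
        shorter-factorisation |z|<|v| = record
          { prefix = z ; suffix = c ∷ w ; factorises = z-factorises ; prefix-length = refl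
          ; length-+ = ℕₚ.≤-antisym
              (subst₂ _≤_ (sym (ℕₚ.+-suc (length z) (length w))) length-+ (ℕₚ.+-monoˡ-≤ (length w) |z|<|v|))
              (subst (length y ≤_) (length-++-embed z (c ∷ w)) (reduced-≤ y-red z-factorises)) }

      suffix-ascent : RightAscent y s → RightAscent (embedded w) s
      suffix-ascent ascent z z∼ws = ℕₚ.≮⇒≥ λ |z|<|w| → ℕₚ.<⇒≱
        (subst₂ _<_ (sym (Listₚ.length-++ v)) (trans (cong (length v ℕ.+_) (Listₚ.length-map (embed s≢t) w)) length-+)
                (ℕₚ.+-monoʳ-< (length v) |z|<|w|))
        (ascent (v ++ z) (begin
          v ++ z                   ≈⟨ ++-cong {v} ∼-refl z∼ws ⟩
          v ++ embedded w ++ [ s ] ≡⟨ Listₚ.++-assoc v (embedded w) [ s ] ⟨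
          (v ++ embedded w) ++ [ s ] ≈⟨ ++-cong factorises (∼-refl {[ s ]}) ⟩
          y ++ [ s ]               ∎))
        where open SetoidReasoning ∼-setoid

      positive : (∀ c → Nonneg (act R v (α (embed s≢t c)))) → RightAscent y s → Nonneg (act R y (α s))
      positive v-positive ascent k = subst (0ℤ ℤ.≤_) (sym y-as-combination)
        (linComb-nonneg (u s) _ (u t) _ (u≥0 s) (u≥0 t) (v-positive S) (v-positive T) k)
        where
        u = act R (embedded w) (α s)
        u≥0 : Nonneg u
        u≥0 = dihedral-positive s≢t w suffix-reduced (suffix-ascent ascent)
        u-split : u ≗ linComb (u s) (α s) (u t) (α t)
        u-split = linComb-α-pair s≢t u (λ j j≢s j≢t → trans (act-embed-other s≢t w (α s) j≢s j≢t) (α-≢ j≢s))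
        y-as-combination : act R y (α s) k ≡ linComb (u s) (act R v (α s)) (u t) (act R v (α t)) k
        y-as-combination = begin
          act R y (α s) k                                   ≡⟨ ∼⇒≈ factorises (α s) k ⟨
          act R (v ++ embedded w) (α s) k                   ≡⟨ act-++ v (embedded w) (α s) k ⟩
          act R v u k                                       ≡⟨ act-cong v u-split k ⟩
          act R v (linComb (u s) (α s) (u t) (α t)) k       ≡⟨ act-linComb v (u s) (α s) (u t) (α t) k ⟩
          linComb (u s) (act R v (α s)) (u t) (act R v (α t)) k ∎
          where open ≡-Reasoning

  -- The prefix of least length is found only classically; the goal is decidable, so this is harmless.
  positive-ascent-acc : ∀ y i → Acc _<_ (length y) → Reduced R y → RightAscent y i → Nonneg (act R y (α i))
  positive-ascent-acc y i _ y-red ascent with List.initLast y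
  positive-ascent-acc _ i _ y-red ascent | List.[] = α-nonneg i
  positive-ascent-acc _ i (acc smaller) y-red ascent | y′ List.∷ʳ′ t =
    decidable-stable (nonneg? _) λ ¬nonneg →
      ¬¬-least (DihedralFactorisation i≢t (y′ ++ [ t ])) (length y′) initial (¬nonneg ∘ from-least)
    where
    |y′|<|y| : length y′ < length (y′ ++ [ t ])
    |y′|<|y| = subst (length y′ <_) (sym (trans (Listₚ.length-++ y′) (ℕₚ.+-comm (length y′) 1))) (ℕₚ.n<1+n (length y′))
    i≢t : i ≢ t
    i≢t refl = rightAscent-∼-shorter [] (y′ ++ [ i ]) y′ ascent ∼-refl |y′|<|y|
    initial : DihedralFactorisation i≢t (y′ ++ [ t ]) (length y′)
    initial = record { prefix = y′ ; suffix = [ T ] ; factorises = ∼-refl ; prefix-length = refl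
                     ; length-+ = sym (Listₚ.length-++ y′) }
    from-least : (∃ λ k → DihedralFactorisation i≢t (y′ ++ [ t ]) k × ∀ j → DihedralFactorisation i≢t (y′ ++ [ t ]) j → k ≤ j) →
                 Nonneg (act R (y′ ++ [ t ]) (α i))
    from-least (k , F , least) = positive (λ c → positive-ascent-acc v (embed i≢t c) (smaller |v|<|y|) prefix-reduced (prefix-ascent c)) ascent
      where
      open LeastFactorisation i≢t y-red F least
      open DihedralFactorisation F renaming (prefix to v)
      |v|<|y| : length v < length (y′ ++ [ t ])
      |v|<|y| = ℕₚ.≤-<-trans (subst (_≤ length y′) (sym prefix-length) (least (length y′) initial)) |y′|<|y|

  positive-ascent : ∀ y i → Reduced R y → RightAscent y i → Nonneg (act R y (α i))
  positive-ascent y i = positive-ascent-acc y i (<-wellFounded (length y))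

  reduced-∷ʳ⇒positive : ∀ y i → Reduced R (y ++ [ i ]) → Nonneg (act R y (α i))
  reduced-∷ʳ⇒positive y i yi-red = positive-ascent y i (reduced-++ˡ y [ i ] yi-red) ascent
    where
    ascent : RightAscent y i
    ascent z z∼yi = ℕₚ.≤-trans (ℕₚ.m≤m+n (length y) 1) (subst (_≤ length z) (Listₚ.length-++ y) (reduced-≤ yi-red z∼yi))


module Support {r : ℕ} (R : CartanData r) where

  open Reflections R
  open Words R
  open Positivity R using (reduced-∷ʳ⇒positive)
  open CartanData R
  open DecMembership (_≟_ {r}) using (_∈?_)

  -- The letter l occurs in u because, at x = q⁻¹(α_l) ≥ 0 for v = p s_l q with l ∉ p,
  -- the element acts on the l-th coordinate as x_l ↦ -1, which a word avoiding l cannot do.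
  reduced-letter-∈ : ∀ {u v l} → Reduced R v → u ∼ v → l ∈ v → l ∈ u
  reduced-letter-∈ {u} {v} {l} v-red u∼v l∈v with l ∈? u
  ... | yes l∈u = l∈u
  ... | no  l∉u with ∈-split-first (_≟_ {r}) l∈v
  ...   | p , q , refl , l∉p = ⊥-elim (ℤₚ.<⇒≱ (ℤ.-<+ {0} {0}) (subst (0ℤ ℤ.≤_) x-at-l (x≥0 l)))
    where
    x : V
    x = act R (reverse q) (α l)
    x≥0 : Nonneg x
    x≥0 = reduced-∷ʳ⇒positive (reverse q) l
            (subst (Reduced R) (Listₚ.unfold-reverse l q) (reduced-reverse (l ∷ q) (reduced-++ʳ p (l ∷ q) v-red)))
    x-at-l : x l ≡ -[1+ 0 ]
    x-at-l = begin
      x l                                      ≡⟨ act-∉ u x l∉u ⟨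
      act R u x l                              ≡⟨ ∼⇒≈ u∼v x l ⟩
      act R (p ++ l ∷ q) x l                   ≡⟨ act-++ p (l ∷ q) x l ⟩
      act R p (reflect l (act R q x)) l        ≡⟨ act-∉ p _ l∉p ⟩
      reflect l (act R q x) l                  ≡⟨ reflect-cong l (act-reverse-inverseʳ q (α l)) l ⟩
      reflect l (α l) l                        ≡⟨ reflect-≡ l (α l) ⟩
      α l l - α∨ l (α l)                       ≡⟨ cong₂ _-_ (α-≡ l) (trans (α∨-α l l) (diag l)) ⟩
      -[1+ 0 ]                                 ∎
      where open ≡-Reasoning

  InSupp-∼ : ∀ {u v i} → u ∼ v → InSupp R u i → InSupp R v i
  InSupp-∼ u∼v (x , x-red , x≈u , i∈x) = x , x-red , ∼⇒≈ (∼-trans (≈⇒∼ {x} x≈u) u∼v) , i∈x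

  ∈⇒InSupp : ∀ {c w i} → Reduced R c → c ∼ w → i ∈ c → InSupp R w i
  ∈⇒InSupp {c} c-red c∼w i∈c = c , c-red , ∼⇒≈ c∼w , i∈c

  InSupp⇒∈ : ∀ {c w i} → Reduced R c → c ∼ w → InSupp R w i → i ∈ c
  InSupp⇒∈ c-red c∼w (x , x-red , x≈w , i∈x) = reduced-letter-∈ x-red (∼-trans c∼w (∼-sym (≈⇒∼ {x} x≈w))) i∈x

  record ReducedWord (w : Word R) : Set where
    field
      word    : Word R
      reduced : Reduced R word
      ∼w      : word ∼ w

  reducedWord : ∀ {w} → Boolean R w → ReducedWord w
  reducedWord (_ , (c , c-red , c≈w , _) , _) = record { word = c ; reduced = c-red ; ∼w = ≈⇒∼ {c} c≈w }

  InSupp? : ∀ {w} → Boolean R w → ∀ i → Dec (InSupp R w i)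
  InSupp? {w} w-bool i = map′ (∈⇒InSupp reduced ∼w) (InSupp⇒∈ reduced ∼w) (i ∈? word)
    where open ReducedWord (reducedWord {w} w-bool)

  -- ℓ(w) = |supp(w)| letters, all of which occur in every reduced word, leave no room for repetitions.
  boolean-reduced-unique : ∀ {w u} → Boolean R w → Reduced R u → u ∼ w → Unique u
  boolean-reduced-unique {w} {u} (n , (c , c-red , c≈w , |c|≡n) , L , L-unique , L⊆supp , _ , |L|≡n) u-red u∼w =
    pigeonhole (_≟_ {r}) L-unique (λ {l} l∈L → InSupp⇒∈ u-red u∼w (L⊆supp l l∈L)) (ℕₚ.≤-reflexive |u|≡|L|)
    where
    |u|≡|L| : length u ≡ length L
    |u|≡|L| = trans (reduced-length-≡ u-red c-red (∼-trans u∼w (∼-sym (≈⇒∼ {c} c≈w)))) (trans |c|≡n (sym |L|≡n))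


module Commutation {r : ℕ} (R : CartanData r) where

  open Reflections R
  open Words R
  open Dihedral R using (a-zero-sym)
  open Positivity R using (reduced-∷ʳ⇒positive)
  open Support R
  open CartanData R

  Adj-sym : ∀ {j k} → Adj R j k → Adj R k j
  Adj-sym (j≢k , inj₁ ajk≢0) = j≢k ∘ sym , inj₂ ajk≢0
  Adj-sym (j≢k , inj₂ akj≢0) = j≢k ∘ sym , inj₁ akj≢0

  Adj⇒a≢0 : ∀ {l i} → Adj R l i → a i l ≢ 0ℤ
  Adj⇒a≢0 {l} {i} (_ , inj₁ ali≢0) ail≡0 = ali≢0 (a-zero-sym i l ail≡0)
  Adj⇒a≢0         (_ , inj₂ ail≢0)       = ail≢0

  ¬Adj⇒a≡0 : ∀ {l i} → l ≢ i → ¬ Adj R l i → a l i ≡ 0ℤ × a i l ≡ 0ℤ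
  ¬Adj⇒a≡0 {l} {i} l≢i ¬adj with a l i ℤ.≟ 0ℤ | a i l ℤ.≟ 0ℤ
  ... | yes ali≡0 | yes ail≡0 = ali≡0 , ail≡0
  ... | no  ali≢0 | _         = ⊥-elim (¬adj (l≢i , inj₁ ali≢0))
  ... | yes _     | no  ail≢0 = ⊥-elim (¬adj (l≢i , inj₂ ail≢0))

  commute-to-front : ∀ p i q → i ∉ p → (∀ {l} → l ∈ p → ¬ Adj R l i) → p ++ i ∷ q ∼ i ∷ p ++ q
  commute-to-front []      i q _   _       = ∼-refl
  commute-to-front (l ∷ p) i q i∉ ¬adj = ≈⇒∼ λ x k →
    trans (reflect-cong l (∼⇒≈ (commute-to-front p i q (i∉ ∘ there) (¬adj ∘ there)) x) k)
          (reflect-comm l≢i (proj₁ a≡0) (proj₂ a≡0) (act R (p ++ q) x) k)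
    where
    l≢i : l ≢ i
    l≢i l≡i = i∉ (here (sym l≡i))
    a≡0 = ¬Adj⇒a≡0 l≢i (¬adj (here refl))

  reflect-nonneg : ∀ {l} y → Nonneg y → y l ≡ 0ℤ → Nonneg (reflect l y)
  reflect-nonneg {l} y y≥0 yl≡0 k with toSum (k ≟ l)
  ... | inj₂ k≢l = subst (0ℤ ℤ.≤_) (sym (reflect-≢ y k≢l)) (y≥0 k)
  ... | inj₁ refl = subst (0ℤ ℤ.≤_) (sym (reflect-≡-at-zero y yl≡0)) (ℤₚ.neg-mono-≤ {α∨ l y} {0ℤ} (sumFin-nonpos r _ term≤0))
    where
    term≤0 : ∀ j → y j * a j l ℤ.≤ 0ℤ
    term≤0 j with toSum (j ≟ l)
    ... | inj₁ refl = ℤₚ.≤-reflexive (trans (cong (_* a j j) yl≡0) (ℤₚ.*-zeroˡ (a j j)))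
    ... | inj₂ j≢l  = *-nonNeg-nonPos (y j) (a j l) (y≥0 j) (offdiag j l j≢l)

  -- ⟨y, α_l^∨⟩ ≤ y_i a_il < 0, since every other term y_j a_jl is ≤ 0.
  reflect-positive : ∀ {i l} y → Nonneg y → y l ≡ 0ℤ → y i ≡ + 1 → Adj R l i → 0ℤ ℤ.< reflect l y l
  reflect-positive {i} {l} y y≥0 yl≡0 yi≡1 adj = subst (0ℤ ℤ.<_) (sym (reflect-≡-at-zero y yl≡0))
    (ℤₚ.<-≤-trans (ℤₚ.neg-mono-< {a i l} {0ℤ} ail<0) (ℤₚ.neg-mono-≤ α∨≤ail))
    where
    ail<0 : a i l ℤ.< 0ℤ
    ail<0 = ℤₚ.≤∧≢⇒< (offdiag i l (proj₁ adj ∘ sym)) (Adj⇒a≢0 adj)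
    α∨≤ail : α∨ l y ℤ.≤ a i l
    α∨≤ail = subst (α∨ l y ℤ.≤_) (trans (cong (_* a i l) yi≡1) (ℤₚ.*-identityˡ (a i l)))
               (sumFin-≤-term r _ i term≤0)
      where
      term≤0 : ∀ j → j ≢ i → y j * a j l ℤ.≤ 0ℤ
      term≤0 j _ with toSum (j ≟ l)
      ... | inj₁ refl = ℤₚ.≤-reflexive (trans (cong (_* a j j) yl≡0) (ℤₚ.*-zeroˡ (a j j)))
      ... | inj₂ j≢l  = *-nonNeg-nonPos (y j) (a j l) (y≥0 j) (offdiag j l j≢l)

  act-reverse-∷ : ∀ x p y → act R (reverse (x ∷ p)) y ≗ act R (reverse p) (reflect x y)
  act-reverse-∷ x p y k = trans (cong (λ w → act R w y k) (Listₚ.unfold-reverse x p)) (act-++ (reverse p) [ x ] y k)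

  -- Along a word without repeated letters the coordinate of a letter l changes only once, when s_l is
  -- applied; if l is adjacent to i, that change makes it positive.
  reverse-act-positive : ∀ {i l} p y → Unique p → i ∉ p → (∀ {m} → m ∈ p → y m ≡ 0ℤ) → Nonneg y → y i ≡ + 1 →
                         l ∈ p → Adj R l i → 0ℤ ℤ.< act R (reverse p) y l
  reverse-act-positive {i} {l} (x ∷ p) y (x∉p ∷ p-unique) i∉ y≡0 y≥0 yi≡1 l∈ adj =
    subst (0ℤ ℤ.<_) (sym (act-reverse-∷ x p y l)) (positive l∈)
    where
    y′≡0 : ∀ {m} → m ∈ p → reflect x y m ≡ 0ℤ
    y′≡0 m∈ = trans (reflect-≢ y (λ { refl → All.lookup x∉p m∈ refl })) (y≡0 (there m∈))
    positive : l ∈ x ∷ p → 0ℤ ℤ.< act R (reverse p) (reflect x y) l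
    positive (here refl) = subst (0ℤ ℤ.<_) (sym (act-∉ (reverse p) _ (λ l∈ → All.lookup x∉p (Anyₚ.reverse⁻ l∈) refl)))
                             (reflect-positive y y≥0 (y≡0 (here refl)) yi≡1 adj)
    positive (there l∈p) = reverse-act-positive p (reflect x y) p-unique (i∉ ∘ there) y′≡0
                             (reflect-nonneg y y≥0 (y≡0 (here refl)))
                             (trans (reflect-≢ y (λ { refl → i∉ (here refl) })) yi≡1) l∈p adj

  act-reflect-α-self : ∀ w i → act R w (reflect i (α i)) ≗ λ k → - act R w (α i) k
  act-reflect-α-self w i k = begin
    act R w (reflect i (α i)) k                                         ≡⟨ act-cong w (reflect-linComb-α i (α i)) k ⟩
    act R w (linComb (+ 1) (α i) (- α∨ i (α i)) (α i)) k                ≡⟨ act-linComb w (+ 1) (α i) (- α∨ i (α i)) (α i) k ⟩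
    + 1 * act R w (α i) k + - α∨ i (α i) * act R w (α i) k
      ≡⟨ cong (λ c → + 1 * act R w (α i) k + - c * act R w (α i) k) (trans (α∨-α i i) (diag i)) ⟩
    + 1 * act R w (α i) k + - + 2 * act R w (α i) k                     ≡⟨ lemma (act R w (α i) k) ⟩
    - act R w (α i) k                                                   ∎
    where
    open ≡-Reasoning
    lemma : ∀ z → + 1 * z + - + 2 * z ≡ - z
    lemma = solve-∀

  -- Compute the l-th coordinate of w⁻¹(α_i) along both words: it is ≤ 0 because s_i is a left
  -- descent, and > 0 along p s_i q.
  left-descent-¬adjacent-before : ∀ {i v p q l} → Reduced R (i ∷ v) → i ∷ v ∼ p ++ i ∷ q → Unique (p ++ i ∷ q) →
                                  l ∈ p → ¬ Adj R l i
  left-descent-¬adjacent-before {i} {v} {p} {q} {l} iv-red iv∼piq unique l∈p adj =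
    ℤₚ.<⇒≱ along-p (subst (ℤ._≤ 0ℤ) (∼⇒≈ (reverse-cong iv∼piq) (α i) l) along-v)
    where
    along-v : act R (reverse (i ∷ v)) (α i) l ℤ.≤ 0ℤ
    along-v = subst (ℤ._≤ 0ℤ) (sym (trans (act-reverse-∷ i v (α i) l) (act-reflect-α-self (reverse v) i l)))
                (ℤₚ.neg-mono-≤ {0ℤ} (reduced-∷ʳ⇒positive (reverse v) i
                  (subst (Reduced R) (Listₚ.unfold-reverse i v) (reduced-reverse (i ∷ v) iv-red)) l))
    i∉p : i ∉ p
    i∉p i∈p = Unique-++-disjoint p unique i∈p (here refl)
    l∉q : l ∉ q
    l∉q l∈q = Unique-++-disjoint p unique l∈p (there l∈q)
    reversed : act R (reverse (p ++ i ∷ q)) (α i) l ≡ act R (reverse p) (α i) l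
    reversed = begin
      act R (reverse (p ++ i ∷ q)) (α i) l                          ≡⟨ cong (λ w → act R w (α i) l) (Listₚ.reverse-++ p (i ∷ q)) ⟩
      act R (reverse (i ∷ q) ++ reverse p) (α i) l                  ≡⟨ act-++ (reverse (i ∷ q)) (reverse p) (α i) l ⟩
      act R (reverse (i ∷ q)) (act R (reverse p) (α i)) l           ≡⟨ act-reverse-∷ i q _ l ⟩
      act R (reverse q) (reflect i (act R (reverse p) (α i))) l     ≡⟨ act-∉ (reverse q) _ (l∉q ∘ Anyₚ.reverse⁻) ⟩
      reflect i (act R (reverse p) (α i)) l                         ≡⟨ reflect-≢ _ (proj₁ adj) ⟩
      act R (reverse p) (α i) l                                     ∎
      where open ≡-Reasoning
    along-p : 0ℤ ℤ.< act R (reverse (p ++ i ∷ q)) (α i) l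
    along-p = subst (0ℤ ℤ.<_) (sym reversed)
      (reverse-act-positive p (α i) (Unique-++⁻ˡ p unique) i∉p (λ m∈ → α-≢ (λ { refl → i∉p m∈ })) (α-nonneg i) (α-≡ i) l∈p adj)

  adjacent-order-invariant : ∀ {v₁ v₂ j k} → Reduced R v₁ → Reduced R v₂ → Unique v₁ → Unique v₂ → v₁ ∼ v₂ →
                             Adj R j k → Precedes v₁ j k → ¬ Precedes v₂ k j
  adjacent-order-invariant {i ∷ v} {j = j} {k} v₁-red v₂-red v₁-unique v₂-unique v₁∼v₂ adj jk kj
    with ∈-∃++ (reduced-letter-∈ v₁-red (∼-sym v₁∼v₂) (here refl))
  ... | p , q , refl with toSum (j ≟ i) | toSum (k ≟ i)
  ...   | inj₁ refl | _         = left-descent-¬adjacent-before v₁-red v₁∼v₂ v₂-unique (Precedes-middle⁻ p v₂-unique kj) (Adj-sym adj)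
  ...   | inj₂ _    | inj₁ refl = Anyₚ.¬Any[] (Precedes-middle⁻ [] v₁-unique jk)
  ...   | inj₂ j≢i  | inj₂ k≢i  = adjacent-order-invariant v-red pq-red (Unique-++⁻ʳ [ i ] v₁-unique)
                                    (Unique-remove-middle p v₂-unique) v∼pq adj (Precedes-∷⁻ jk j≢i) (Precedes-remove-middle p kj k≢i j≢i)
    where
    v∼pq : v ∼ p ++ q
    v∼pq = ∷-cancel i (∼-trans v₁∼v₂ (commute-to-front p i q (λ i∈p → Unique-++-disjoint p v₂-unique i∈p (here refl))
                                                           (λ l∈p → left-descent-¬adjacent-before v₁-red v₁∼v₂ v₂-unique l∈p)))
    v-red : Reduced R v
    v-red = reduced-++ʳ [ i ] v v₁-red
    pq-red : Reduced R (p ++ q)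
    pq-red = reduced-resp v-red (∼-sym v∼pq)
               (ℕₚ.suc-injective (trans (sym (length-insert-middle p)) (reduced-length-≡ v₂-red v₁-red (∼-sym v₁∼v₂))))

  Before⇒Arrow : ∀ {w j k} → Adj R j k → Before R w j k → Arrow R w k j
  Before⇒Arrow adj before@(v , v-red , v≈w , p , _ , _ , refl) =
    (v , v-red , v≈w , Precedes⇒∈ˡ (Precedes-++ p)) , (v , v-red , v≈w , Precedes⇒∈ʳ (Precedes-++ p)) , adj , before

  Before-asym : ∀ {w j k} → Boolean R w → Adj R j k → Before R w j k → ¬ Before R w k j
  Before-asym {w} w-bool adj (v₁ , v₁-red , v₁≈w , p₁ , _ , _ , refl) (v₂ , v₂-red , v₂≈w , p₂ , _ , _ , refl) =
    adjacent-order-invariant v₁-red v₂-red (boolean-reduced-unique {w} w-bool v₁-red v₁∼w)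
      (boolean-reduced-unique {w} w-bool v₂-red v₂∼w) (∼-trans v₁∼w (∼-sym v₂∼w)) adj (Precedes-++ p₁) (Precedes-++ p₂)
    where
    v₁∼w = ≈⇒∼ {v₁} {w} v₁≈w
    v₂∼w = ≈⇒∼ {v₂} {w} v₂≈w

  same-adjacent-order⇒∼ : ∀ {v₁ v₂} → Unique v₁ → Unique v₂ → v₁ ⊆ v₂ → v₂ ⊆ v₁ →
                          (∀ {j k} → Adj R j k → Precedes v₁ j k → Precedes v₂ j k) → v₁ ∼ v₂
  same-adjacent-order⇒∼ {[]}    {[]}    _ _ _ _ _ = ∼-refl
  same-adjacent-order⇒∼ {[]}    {_ ∷ _} _ _ _ v₂⊆v₁ _ = ⊥-elim (Anyₚ.¬Any[] (v₂⊆v₁ (here refl)))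
  same-adjacent-order⇒∼ {i ∷ v} {v₂} (i∉v ∷ v-unique) v₂-unique v₁⊆v₂ v₂⊆v₁ same-order
    with ∈-∃++ (v₁⊆v₂ (here refl))
  ... | p , q , refl =
    ∼-trans (∷-cong i (same-adjacent-order⇒∼ v-unique (Unique-remove-middle p v₂-unique) v⊆pq pq⊆v same-order′))
            (∼-sym (commute-to-front p i q i∉p ¬adjacent-before))
    where
    i∉pq : i ∉ p ++ q
    i∉pq = Unique-middle-∉ p v₂-unique
    i∉p : i ∉ p
    i∉p = i∉pq ∘ ∈-++⁺ˡ
    ≢i : ∀ {l} → l ∈ v → l ≢ i
    ≢i l∈v refl = All.lookup i∉v l∈v refl
    v⊆pq : v ⊆ p ++ q
    v⊆pq l∈v = ∈-remove-middle p (v₁⊆v₂ (there l∈v)) (≢i l∈v)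
    pq⊆v : p ++ q ⊆ v
    pq⊆v l∈pq with v₂⊆v₁ (∈-insert-middle p l∈pq)
    ... | here refl = ⊥-elim (i∉pq l∈pq)
    ... | there l∈v = l∈v
    ¬adjacent-before : ∀ {l} → l ∈ p → ¬ Adj R l i
    ¬adjacent-before l∈p adj =
      Precedes-asym v₂-unique (same-order (Adj-sym adj) (here (pq⊆v (∈-++⁺ˡ l∈p)))) (Precedes-middle p l∈p)
    same-order′ : ∀ {j k} → Adj R j k → Precedes v j k → Precedes (p ++ q) j k
    same-order′ adj jk = Precedes-remove-middle p (same-order adj (there jk)) (≢i (Precedes⇒∈ˡ jk)) (≢i (Precedes⇒∈ʳ jk))

  boolean-∼ : ∀ {X X′} → Boolean R X → Boolean R X′ →
              (∀ i → InSupp R X i → InSupp R X′ i) → (∀ i → InSupp R X′ i → InSupp R X i) →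
              (∀ {j k} → Adj R j k → Before R X j k → ¬ Before R X′ k j) → X ∼ X′
  boolean-∼ {X} {X′} X-bool X′-bool X⊆X′ X′⊆X consistent = begin
    X   ≈⟨ ∼-sym c∼X ⟩
    c   ≈⟨ same-adjacent-order⇒∼ (boolean-reduced-unique {X} X-bool c-red c∼X) (boolean-reduced-unique {X′} X′-bool c′-red c′∼X′)
                                 c⊆c′ c′⊆c same-order ⟩
    c′  ≈⟨ c′∼X′ ⟩
    X′  ∎
    where
    open SetoidReasoning ∼-setoid
    open ReducedWord (reducedWord {X} X-bool) renaming (word to c; reduced to c-red; ∼w to c∼X)
    open ReducedWord (reducedWord {X′} X′-bool) renaming (word to c′; reduced to c′-red; ∼w to c′∼X′)
    c⊆c′ : c ⊆ c′
    c⊆c′ {l} l∈c = InSupp⇒∈ c′-red c′∼X′ (X⊆X′ l (∈⇒InSupp c-red c∼X l∈c))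
    c′⊆c : c′ ⊆ c
    c′⊆c {l} l∈c′ = InSupp⇒∈ c-red c∼X (X′⊆X l (∈⇒InSupp c′-red c′∼X′ l∈c′))
    same-order : ∀ {j k} → Adj R j k → Precedes c j k → Precedes c′ j k
    same-order adj jk with Precedes-total (c⊆c′ (Precedes⇒∈ˡ jk)) (c⊆c′ (Precedes⇒∈ʳ jk)) (proj₁ adj)
    ... | inj₁ jk′ = jk′
    ... | inj₂ kj′ = ⊥-elim (consistent adj (c , c-red , ∼⇒≈ c∼X , Precedes⇒++ jk) (c′ , c′-red , ∼⇒≈ c′∼X′ , Precedes⇒++ kj′))


module PathInsertion {r : ℕ} (R : CartanData r) (path : DynkinIsPath R) where

  open Words R
  open Support R
  open Commutation R

  pos : Fin r → ℕ
  pos i = toℕ (proj₁ path ⟨$⟩ʳ i)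

  pos-injective : ∀ {i j} → pos i ≡ pos j → i ≡ j
  pos-injective {i} {j} eq = begin
    i                              ≡⟨ inverseˡ (proj₁ path) ⟨
    proj₁ path ⟨$⟩ˡ (proj₁ path ⟨$⟩ʳ i) ≡⟨ cong (proj₁ path ⟨$⟩ˡ_) (Finₚ.toℕ-injective eq) ⟩
    proj₁ path ⟨$⟩ˡ (proj₁ path ⟨$⟩ʳ j) ≡⟨ inverseˡ (proj₁ path) ⟩
    j                              ∎
    where open ≡-Reasoning

  Arrow⇒consecutive : ∀ {X k j} → Arrow R X k j → pos j ≡ suc (pos k) ⊎ pos k ≡ suc (pos j)
  Arrow⇒consecutive (_ , _ , adj , _) = proj₁ (proj₂ path _ _) adj

  walk-up : ∀ {X b e vs} → WalkIn R X b e vs → ∀ c → pos b ≤ c → c < pos e →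
            ∃₂ λ x y → Arrow R X x y × pos x ≡ c × pos y ≡ suc c
  walk-up (here _) c b≤c c<b = ⊥-elim (ℕₚ.<⇒≱ c<b b≤c)
  walk-up {X} (step b b′ _ _ arrow rest) c b≤c c<e with Arrow⇒consecutive {X} arrow
  ... | inj₂ down = walk-up rest c (ℕₚ.≤-trans (ℕₚ.n≤1+n (pos b′)) (subst (_≤ c) down b≤c)) c<e
  ... | inj₁ up with pos b ℕₚ.≟ c
  ...   | yes b≡c = b , b′ , arrow , b≡c , trans up (cong suc b≡c)
  ...   | no  b≢c = walk-up rest c (subst (_≤ c) (sym up) (ℕₚ.≤∧≢⇒< b≤c b≢c)) c<e

  walk-down : ∀ {X b e vs} → WalkIn R X b e vs → ∀ c → pos e ≤ c → c < pos b →
              ∃₂ λ x y → Arrow R X x y × pos x ≡ suc c × pos y ≡ c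
  walk-down (here _) c b≤c c<b = ⊥-elim (ℕₚ.<⇒≱ c<b b≤c)
  walk-down {X} (step b b′ _ _ arrow rest) c e≤c c<b with Arrow⇒consecutive {X} arrow
  ... | inj₁ up = walk-down rest c e≤c (subst (c <_) (sym up) (ℕₚ.m<n⇒m<1+n c<b))
  ... | inj₂ down with pos b′ ℕₚ.≟ c
  ...   | yes b′≡c = b , b′ , arrow , trans down (cong suc b′≡c) , b′≡c
  ...   | no  b′≢c = walk-down rest c e≤c (ℕₚ.≤∧≢⇒< (ℕₚ.≤-pred (subst (suc c ≤_) down c<b)) (b′≢c ∘ sym))

  walk-enters : ∀ {X b e vs} → WalkIn R X b e vs → ∀ c → (pos b < c × c ≤ pos e) ⊎ (pos e ≤ c × c < pos b) →
                ∃₂ λ x y → Arrow R X x y × pos y ≡ c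
  walk-enters walk (suc c) (inj₁ (b<c , c≤e)) with walk-up walk c (ℕₚ.≤-pred b<c) c≤e
  ... | x , y , arrow , _ , y≡c = x , y , arrow , y≡c
  walk-enters walk c (inj₂ (e≤c , c<b)) with walk-down walk c e≤c c<b
  ... | x , y , arrow , _ , y≡c = x , y , arrow , y≡c

  walk-leaves-upward : ∀ {X b e vs} → WalkIn R X b e vs → pos b < pos e → ∃ λ y → Arrow R X b y × pos y ≡ suc (pos b)
  walk-leaves-upward {X} walk b<e with walk-up walk _ ℕₚ.≤-refl b<e
  ... | x , y , arrow , x≡b , y≡ = y , subst (λ x → Arrow R X x y) (pos-injective x≡b) arrow , y≡

  walk-leaves-downward : ∀ {X b e vs} → WalkIn R X b e vs → pos e < pos b → ∃ λ y → Arrow R X b y × pos b ≡ suc (pos y)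
  walk-leaves-downward {X} {b} {e} walk e<b with pos b in b≡ | e<b
  ... | suc c | s≤s e≤c with walk-down walk c e≤c (subst (c <_) (sym b≡) ℕₚ.≤-refl)
  ...   | x , y , arrow , x≡ , y≡c = y , subst (λ x → Arrow R X x y) (pos-injective (trans x≡ (sym b≡))) arrow , cong suc (sym y≡c)

  walk-passes : ∀ {X b e vs} → WalkIn R X b e vs → ∀ c → (pos b < c × c < pos e) ⊎ (pos e < c × c < pos b) →
                ∃ λ x → InSupp R X x × pos x ≡ c
  walk-passes walk c (inj₁ (b<c , c<e)) with walk-up walk c (ℕₚ.<⇒≤ b<c) c<e
  ... | x , _ , (_ , x∈ , _) , x≡c , _ = x , x∈ , x≡c
  walk-passes walk c (inj₂ (e<c , c<b)) with walk-down walk c (ℕₚ.<⇒≤ e<c) c<b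
  ... | _ , y , (y∈ , _) , _ , y≡c = y , y∈ , y≡c

  record Step (u : Word R) (β : Fin r) (v : Word R) : Set where
    field
      u-bool : Boolean R u
      v-bool : Boolean R v
      γ      : Fin r
      γ∉u    : ¬ InSupp R u γ
      γ∈v    : InSupp R v γ
      u⊆v    : ∀ i → InSupp R u i → InSupp R v i
      v⊆u+γ  : ∀ i → InSupp R v i → InSupp R u i ⊎ i ≡ γ
      arrows : ∀ k j → Arrow R u k j → Arrow R v k j
      route  : β ≡ γ ⊎ (InSupp R u β × HasPath R v β γ)

  insertion-step : ∀ {u β v} → Insertion R u β v → Step u β v
  insertion-step {u} {β} {v} (u-bool , v-bool , inj₁ (β∈u , _ , (u⊆v , arrows) , γ , (γ∈v , γ∉u , only-γ) , β⇝γ)) = record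
    { u-bool = u-bool ; v-bool = v-bool ; γ = γ ; γ∉u = γ∉u ; γ∈v = γ∈v ; u⊆v = u⊆v ; arrows = arrows
    ; v⊆u+γ = λ i i∈v → Sum.map₂ (only-γ i i∈v) (toSum (InSupp? {u} u-bool i))
    ; route = inj₂ (β∈u , β⇝γ) }
  insertion-step {u} {β} {v} (u-bool , v-bool , inj₂ (β∉u , _ , (u⊆v , arrows) , only-β , β∈v)) = record
    { u-bool = u-bool ; v-bool = v-bool ; γ = β ; γ∉u = β∉u ; γ∈v = β∈v ; u⊆v = u⊆v ; arrows = arrows
    ; v⊆u+γ = λ i i∈v → Sum.map₂ (only-β i i∈v) (toSum (InSupp? {u} u-bool i))
    ; route = inj₁ refl }

  arrows-along : ∀ {X S vs k j} → InsSeq R X S vs → Arrow R X k j → Arrow R (endpoint R X vs) k j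
  arrows-along (done _)                   arrow = arrow
  arrows-along (cons u β v _ _ ins rest) arrow = arrows-along rest (Step.arrows (insertion-step {u} {β} {v} ins) _ _ arrow)

  Arrow-∼ : ∀ {X Y k j} → X ∼ Y → Arrow R X k j → Arrow R Y k j
  Arrow-∼ X∼Y (j∈ , k∈ , adj , (v , v-red , v≈X , before)) =
    InSupp-∼ X∼Y j∈ , InSupp-∼ X∼Y k∈ , adj , (v , v-red , ∼⇒≈ (∼-trans (≈⇒∼ {v} v≈X) X∼Y) , before)

  𝟙 : Bool → ℕ
  𝟙 true  = 1
  𝟙 false = 0

  sum-update : ∀ {n} (f g : Fin n → ℕ) i → (∀ j → j ≢ i → f j ≡ g j) → g i ≡ 0 → sum f ≡ sum g ℕ.+ f i
  sum-update {suc n} f g i f≡g gi≡0 = begin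
    sum f                                       ≡⟨ sum-remove {i = i} f ⟩
    f i ℕ.+ sum (f ∘ punchIn i)                 ≡⟨ cong (f i ℕ.+_) (sum-cong-≗ (λ j → f≡g _ (Finₚ.punchInᵢ≢i i j))) ⟩
    f i ℕ.+ sum (g ∘ punchIn i)                 ≡⟨ cong (λ z → f i ℕ.+ (z ℕ.+ sum (g ∘ punchIn i))) gi≡0 ⟨
    f i ℕ.+ (g i ℕ.+ sum (g ∘ punchIn i))       ≡⟨ cong (f i ℕ.+_) (sum-remove {i = i} g) ⟨
    f i ℕ.+ sum g                               ≡⟨ ℕₚ.+-comm (f i) (sum g) ⟩
    sum g ℕ.+ f i                               ∎
    where open ≡-Reasoning

  𝟙-⇔ : ∀ {A B : Set} (a? : Dec A) (b? : Dec B) → (A → B) → (B → A) → 𝟙 (does a?) ≡ 𝟙 (does b?)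
  𝟙-⇔ a? b? A→B B→A = cong 𝟙 (does-⇔ (mk⇔ A→B B→A) a? b?)

  countAbove : ∀ X → Boolean R X → ℕ → ℕ
  countAbove X X-bool c = sum λ x → 𝟙 (does (InSupp? {X} X-bool x ×-dec c <? pos x))

  countAbove-cong : ∀ {X Y} (X-bool : Boolean R X) (Y-bool : Boolean R Y) →
                    (∀ i → InSupp R X i → InSupp R Y i) → (∀ i → InSupp R Y i → InSupp R X i) →
                    ∀ c → countAbove X X-bool c ≡ countAbove Y Y-bool c
  countAbove-cong {X} {Y} X-bool Y-bool X⊆Y Y⊆X c = sum-cong-≗ λ x →
    𝟙-⇔ (InSupp? {X} X-bool x ×-dec c <? pos x) (InSupp? {Y} Y-bool x ×-dec c <? pos x)
        (Product.map₁ (X⊆Y x)) (Product.map₁ (Y⊆X x))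

  countAbove-step : ∀ {u β v} (st : Step u β v) c →
                    countAbove v (Step.v-bool st) c ≡ countAbove u (Step.u-bool st) c ℕ.+ 𝟙 (does (c <? pos (Step.γ st)))
  countAbove-step {u} {β} {v} st c = trans (sum-update _ _ γ unchanged γ-absent) (cong (countAbove u u-bool c ℕ.+_) γ-new)
    where
    open Step st
    unchanged : ∀ x → x ≢ γ → 𝟙 (does (InSupp? {v} v-bool x ×-dec c <? pos x)) ≡ 𝟙 (does (InSupp? {u} u-bool x ×-dec c <? pos x))
    unchanged x x≢γ = 𝟙-⇔ (InSupp? {v} v-bool x ×-dec c <? pos x) (InSupp? {u} u-bool x ×-dec c <? pos x)
                          (Product.map₁ v→u) (Product.map₁ (u⊆v x))
      where
      v→u : InSupp R v x → InSupp R u x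
      v→u x∈v = Sum.[ (λ x∈u → x∈u) , (λ x≡γ → ⊥-elim (x≢γ x≡γ)) ]′ (v⊆u+γ x x∈v)
    γ-absent : 𝟙 (does (InSupp? {u} u-bool γ ×-dec c <? pos γ)) ≡ 0
    γ-absent = cong 𝟙 (dec-false (InSupp? {u} u-bool γ ×-dec c <? pos γ) (γ∉u ∘ proj₁))
    γ-new : 𝟙 (does (InSupp? {v} v-bool γ ×-dec c <? pos γ)) ≡ 𝟙 (does (c <? pos γ))
    γ-new = 𝟙-⇔ (InSupp? {v} v-bool γ ×-dec c <? pos γ) (c <? pos γ) proj₂ (γ∈v ,_)

  -- A vertex strictly between β and the new vertex would lie on the path from β, hence already in B(u).
  new-vertex-nearest : ∀ {u β v δ} (st : Step u β v) → ¬ InSupp R u δ → δ ≢ Step.γ st →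
                       ∀ {ps} → WalkIn R v β (Step.γ st) ps →
                       ¬ ((pos β < pos δ × pos δ < pos (Step.γ st)) ⊎ (pos (Step.γ st) < pos δ × pos δ < pos β))
  new-vertex-nearest {δ = δ} st δ∉u δ≢γ walk between with walk-passes walk (pos δ) between
  ... | x , x∈v , x≡δ with Step.v⊆u+γ st x x∈v | pos-injective x≡δ
  ...   | inj₁ δ∈u | refl = δ∉u δ∈u
  ...   | inj₂ δ≡γ | refl = δ≢γ δ≡γ

  countAboveIn : ℕ → List (Fin r) → ℕ
  countAboveIn c []      = 0
  countAboveIn c (β ∷ S) = 𝟙 (does (c <? pos β)) ℕ.+ countAboveIn c S

  module _ (w : Word R) (w-bool : Boolean R w) where

    arrows-to : ∀ {X S vs} → InsSeq R X S vs → endpoint R X vs ∼ w → ∀ k j → Arrow R X k j → Arrow R w k j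
    arrows-to seq end∼w k j = Arrow-∼ end∼w ∘ arrows-along seq

    Arrow-asym : ∀ {x y} → Arrow R w x y → ¬ Arrow R w y x
    Arrow-asym (_ , _ , adj , before) (_ , _ , _ , before′) = Before-asym {w} w-bool adj before before′

    record Continuation (X : Word R) (β : Fin r) (S : List (Fin r)) : Set where
      field
        {next}  : Word R
        {later} : List (Word R)
        st      : Step X β next
        rest    : InsSeq R next S later
        end∼w   : endpoint R next later ∼ w
      open Step st public

    SameSupport : Word R → Word R → Set
    SameSupport X X′ = (∀ i → InSupp R X i → InSupp R X′ i) × (∀ i → InSupp R X′ i → InSupp R X i)

    -- Across a vertex β without incoming arrows in B(w), no later insertion can cross position pos β,
    -- so the vertices above pos β are those of the start plus one for each later letter above pos β.
    module Source {β} (source : ∀ x → ¬ Arrow R w x β) where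

      same-side : ∀ {Y β′ Y₁} (st : Step Y β′ Y₁) → β′ ≢ β → (∀ k j → Arrow R Y₁ k j → Arrow R w k j) →
                  𝟙 (does (pos β <? pos (Step.γ st))) ≡ 𝟙 (does (pos β <? pos β′))
      same-side {β′ = β′} {Y₁} st β′≢β to-w with Step.route st
      ... | inj₁ refl = refl
      ... | inj₂ (_ , _ , walk , _) = 𝟙-⇔ (pos β <? pos γ) (pos β <? pos β′) up down
        where
        open Step st using (γ)
        no-entry : ¬ (∃₂ λ x y → Arrow R Y₁ x y × pos y ≡ pos β)
        no-entry (x , y , arrow , y≡β) = source x (subst (Arrow R w x) (pos-injective y≡β) (to-w x y arrow))
        up : pos β < pos γ → pos β < pos β′
        up β<γ with pos β <? pos β′
        ... | yes β<β′ = β<β′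
        ... | no  β≮β′ = ⊥-elim (no-entry (walk-enters walk (pos β)
                           (inj₁ (ℕₚ.≤∧≢⇒< (ℕₚ.≮⇒≥ β≮β′) (β′≢β ∘ pos-injective) , ℕₚ.<⇒≤ β<γ))))
        down : pos β < pos β′ → pos β < pos γ
        down β<β′ with pos β <? pos γ
        ... | yes β<γ = β<γ
        ... | no  β≮γ = ⊥-elim (no-entry (walk-enters walk (pos β) (inj₂ (ℕₚ.≮⇒≥ β≮γ , β<β′))))

      countAbove-along : ∀ {Y S ys} (Y-bool : Boolean R Y) → InsSeq R Y S ys → β ∉ S → endpoint R Y ys ∼ w →
                         countAbove w w-bool (pos β) ≡ countAbove Y Y-bool (pos β) ℕ.+ countAboveIn (pos β) S
      countAbove-along {Y} Y-bool (done _) _ Y∼w = begin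
        countAbove w w-bool (pos β)
          ≡⟨ countAbove-cong {w} {Y} w-bool Y-bool (λ i → InSupp-∼ (∼-sym Y∼w)) (λ i → InSupp-∼ Y∼w) (pos β) ⟩
        countAbove Y Y-bool (pos β)
          ≡⟨ ℕₚ.+-identityʳ _ ⟨
        countAbove Y Y-bool (pos β) ℕ.+ 0
          ∎
        where open ≡-Reasoning
      countAbove-along {Y} Y-bool (cons _ β′ Y₁ S _ ins rest) β∉ end∼w = begin
        countAbove w w-bool (pos β)
          ≡⟨ countAbove-along v-bool rest (β∉ ∘ there) end∼w ⟩
        countAbove Y₁ v-bool (pos β) ℕ.+ countAboveIn (pos β) S
          ≡⟨ cong (ℕ._+ countAboveIn (pos β) S) (countAbove-step st (pos β)) ⟩
        (countAbove Y u-bool (pos β) ℕ.+ 𝟙 (does (pos β <? pos γ))) ℕ.+ countAboveIn (pos β) S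
          ≡⟨ cong₂ (λ m n → (m ℕ.+ n) ℕ.+ countAboveIn (pos β) S)
                   (countAbove-cong {Y} {Y} u-bool Y-bool (λ _ i∈ → i∈) (λ _ i∈ → i∈) (pos β))
                   (same-side st (λ β′≡β → β∉ (here (sym β′≡β))) (arrows-to rest end∼w)) ⟩
        (countAbove Y Y-bool (pos β) ℕ.+ 𝟙 (does (pos β <? pos β′))) ℕ.+ countAboveIn (pos β) S
          ≡⟨ ℕₚ.+-assoc (countAbove Y Y-bool (pos β)) _ _ ⟩
        countAbove Y Y-bool (pos β) ℕ.+ countAboveIn (pos β) (β′ ∷ S) ∎
        where
        open ≡-Reasoning
        st = insertion-step {Y} {β′} {Y₁} ins
        open Step st

      countAbove-continuation : ∀ {X S} → β ∉ S → (A : Continuation X β S) → let open Continuation A in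
        countAbove w w-bool (pos β) ≡ (countAbove X u-bool (pos β) ℕ.+ 𝟙 (does (pos β <? pos γ))) ℕ.+ countAboveIn (pos β) S
      countAbove-continuation β∉S A = trans (countAbove-along v-bool rest β∉S end∼w) (cong (ℕ._+ _) (countAbove-step st (pos β)))
        where open Continuation A

    -- β leaves downwards in one continuation and upwards in the other, hence has no incoming arrow in
    -- B(w); counting the vertices above β then gives two values differing by one.
    opposite-sides-impossible : ∀ {X X′ β S} → SameSupport X X′ → β ∉ S → (A : Continuation X β S) (B : Continuation X′ β S) →
      ∀ {ps ps′} → WalkIn R (Continuation.next A) β (Continuation.γ A) ps → WalkIn R (Continuation.next B) β (Continuation.γ B) ps′ →
      pos (Continuation.γ A) < pos β → pos β < pos (Continuation.γ B) → ⊥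
    opposite-sides-impossible {X} {X′} {β} {S} (X⊆X′ , X′⊆X) β∉S A B walkA walkB γA<β β<γB =
      ℕₚ.0≢1+n (ℕₚ.+-cancelˡ-≡ (countAbove X A.u-bool c) 0 1 (ℕₚ.+-cancelʳ-≡ (countAboveIn c S) _ _ (begin
        (countAbove X A.u-bool c ℕ.+ 0) ℕ.+ countAboveIn c S
          ≡⟨ cong (λ z → (countAbove X A.u-bool c ℕ.+ z) ℕ.+ countAboveIn c S) (cong 𝟙 (dec-false (c <? pos A.γ) (ℕₚ.<⇒≯ γA<β))) ⟨
        (countAbove X A.u-bool c ℕ.+ 𝟙 (does (c <? pos A.γ))) ℕ.+ countAboveIn c S
          ≡⟨ Source.countAbove-continuation source β∉S A ⟨
        countAbove w w-bool c
          ≡⟨ Source.countAbove-continuation source β∉S B ⟩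
        (countAbove X′ B.u-bool c ℕ.+ 𝟙 (does (c <? pos B.γ))) ℕ.+ countAboveIn c S
          ≡⟨ cong₂ (λ m n → (m ℕ.+ n) ℕ.+ countAboveIn c S) (countAbove-cong {X′} {X} B.u-bool A.u-bool X′⊆X X⊆X′ c)
                   (cong 𝟙 (dec-true (c <? pos B.γ) β<γB)) ⟩
        (countAbove X A.u-bool c ℕ.+ 1) ℕ.+ countAboveIn c S ∎)))
      where
      module A = Continuation A
      module B = Continuation B
      open ≡-Reasoning
      c = pos β
      source : ∀ x → ¬ Arrow R w x β
      source x x→β with walk-leaves-downward walkA γA<β | walk-leaves-upward walkB β<γB | Arrow⇒consecutive {w} x→β
      ... | y , β→y , β≡1+y | _ | inj₁ β≡1+x =
        Arrow-asym (arrows-to A.rest A.end∼w β y β→y)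
                   (subst (λ z → Arrow R w z β) (pos-injective (ℕₚ.suc-injective (trans (sym β≡1+x) β≡1+y))) x→β)
      ... | _ | y , β→y , y≡1+β | inj₂ x≡1+β =
        Arrow-asym (arrows-to B.rest B.end∼w β y β→y)
                   (subst (λ z → Arrow R w z β) (pos-injective (trans x≡1+β (sym y≡1+β))) x→β)

    new-vertex-unique : ∀ {X X′ β S} → SameSupport X X′ → β ∉ S → (A : Continuation X β S) (B : Continuation X′ β S) →
                        Continuation.γ A ≡ Continuation.γ B
    new-vertex-unique {X} {X′} {β} (X⊆X′ , X′⊆X) β∉S A B with Continuation.route A | Continuation.route B
    ... | inj₁ β≡γ         | inj₁ β≡γ′        = trans (sym β≡γ) β≡γ′
    ... | inj₁ refl        | inj₂ (β∈X′ , _) = ⊥-elim (Continuation.γ∉u A (X′⊆X β β∈X′))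
    ... | inj₂ (β∈X , _)   | inj₁ refl        = ⊥-elim (Continuation.γ∉u B (X⊆X′ β β∈X))
    ... | inj₂ (β∈X , _ , walkA , _) | inj₂ (β∈X′ , _ , walkB , _) with Continuation.γ A ≟ Continuation.γ B
    ...   | yes γ≡γ′ = γ≡γ′
    ...   | no  γ≢γ′ = ⊥-elim (compare (ℕₚ.<-cmp (pos γ) (pos β)) (ℕₚ.<-cmp (pos γ′) (pos β)) (ℕₚ.<-cmp (pos γ) (pos γ′)))
      where
      module A = Continuation A
      module B = Continuation B
      γ = A.γ
      γ′ = B.γ
      γ′∉X : ¬ InSupp R X γ′
      γ′∉X = B.γ∉u ∘ X⊆X′ γ′
      γ∉X′ : ¬ InSupp R X′ γ
      γ∉X′ = A.γ∉u ∘ X′⊆X γ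
      compare : Tri (pos γ < pos β) (pos γ ≡ pos β) (pos β < pos γ) → Tri (pos γ′ < pos β) (pos γ′ ≡ pos β) (pos β < pos γ′) →
                Tri (pos γ < pos γ′) (pos γ ≡ pos γ′) (pos γ′ < pos γ) → ⊥
      compare (tri≈ _ γ≡β _) _ _ = A.γ∉u (subst (InSupp R X) (sym (pos-injective γ≡β)) β∈X)
      compare _ (tri≈ _ γ′≡β _) _ = B.γ∉u (subst (InSupp R X′) (sym (pos-injective γ′≡β)) β∈X′)
      compare _ _ (tri≈ _ γ≡γ′ _) = γ≢γ′ (pos-injective γ≡γ′)
      compare (tri< γ<β _ _) (tri> _ _ β<γ′) _ = opposite-sides-impossible (X⊆X′ , X′⊆X) β∉S A B walkA walkB γ<β β<γ′
      compare (tri> _ _ β<γ) (tri< γ′<β _ _) _ = opposite-sides-impossible (X′⊆X , X⊆X′) β∉S B A walkB walkA γ′<β β<γ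
      compare (tri< _ _ _) (tri< γ′<β _ _) (tri< γ<γ′ _ _) = new-vertex-nearest A.st γ′∉X (γ≢γ′ ∘ sym) walkA (inj₂ (γ<γ′ , γ′<β))
      compare (tri< γ<β _ _) (tri< _ _ _) (tri> _ _ γ′<γ) = new-vertex-nearest B.st γ∉X′ γ≢γ′ walkB (inj₂ (γ′<γ , γ<β))
      compare (tri> _ _ β<γ) (tri> _ _ _) (tri< γ<γ′ _ _) = new-vertex-nearest B.st γ∉X′ γ≢γ′ walkB (inj₁ (β<γ , γ<γ′))
      compare (tri> _ _ _) (tri> _ _ β<γ′) (tri> _ _ γ′<γ) = new-vertex-nearest A.st γ′∉X (γ≢γ′ ∘ sym) walkA (inj₁ (β<γ′ , γ′<γ))

    paths-agree : ∀ {X X′ S vs vs′} → SameSupport X X′ → Unique S → InsSeq R X S vs → InsSeq R X′ S vs′ →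
                  endpoint R X vs ∼ w → endpoint R X′ vs′ ∼ w → Pointwise _∼_ vs vs′
    paths-agree _ _ (done _) (done _) _ _ = []
    paths-agree {X} {X′} same (β∉S ∷ S-unique) (cons _ β v S vs ins rest) (cons _ _ v′ _ vs′ ins′ rest′) end∼w end′∼w =
      v∼v′ ∷ paths-agree same′ S-unique rest rest′ end∼w end′∼w
      where
      A : Continuation X β S
      A = record { st = insertion-step {X} {β} {v} ins ; rest = rest ; end∼w = end∼w }
      B : Continuation X′ β S
      B = record { st = insertion-step {X′} {β} {v′} ins′ ; rest = rest′ ; end∼w = end′∼w }
      module A = Continuation A
      module B = Continuation B
      γ≡γ′ : A.γ ≡ B.γ
      γ≡γ′ = new-vertex-unique same (Allₚ.All¬⇒¬Any β∉S) A B
      same′ : SameSupport v v′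
      same′ = (λ i i∈v → Sum.[ B.u⊆v i ∘ proj₁ same i , (λ { refl → subst (InSupp R v′) (sym γ≡γ′) B.γ∈v }) ]′ (A.v⊆u+γ i i∈v))
            , (λ i i∈v′ → Sum.[ A.u⊆v i ∘ proj₂ same i , (λ { refl → subst (InSupp R v) γ≡γ′ A.γ∈v }) ]′ (B.v⊆u+γ i i∈v′))
      v∼v′ : v ∼ v′
      v∼v′ = boolean-∼ {v} {v′} A.v-bool B.v-bool (proj₁ same′) (proj₂ same′) λ {j} {k} adj jk kj →
        Arrow-asym (arrows-to rest end∼w k j (Before⇒Arrow {v} adj jk)) (arrows-to rest′ end′∼w j k (Before⇒Arrow {v′} (Adj-sym adj) kj))


proposition3p14 : (r : ℕ) (R : CartanData r) → DynkinIsPath R →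
    (S : List (Fin r)) → Unique S →
    (u w : Word R) → Boolean R u → Boolean R w →
    (vs vs′ : List (Word R)) → InsPath R u S w vs → InsPath R u S w vs′ →
    Pointwise (_≈_ R) vs vs′
proposition3p14 r R path S S-unique u w _ w-bool vs vs′ (seq , end≈w) (seq′ , end′≈w) =
  Pointwise.map ∼⇒≈ (paths-agree w w-bool ((λ _ i∈u → i∈u) , (λ _ i∈u → i∈u)) S-unique seq seq′ (≈⇒∼ end≈w) (≈⇒∼ end′≈w))
  where
  -- every insertion step records that its source is boolean
  open Words R
  open PathInsertion R path
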